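{- For $d \geq 1$ let $$P_d(X,Y) = d \sum_{\substack{k,l \geq 0 \\ 0 \leq 2k+3l \leq d}} (-1)^{k-1}\binom{k+l}{k}\binom{d-k-2l}{k+l}\frac{X^k Y^{d-2k-3l}}{d-k-2l} \in \mathbb{Z}[X,Y].$$ Let $a, b \in \mathbb{Z}$ be nonzero with $c := a+b \neq 0$, and set $$S_{a,b}(T) = \frac{1}{T^a} + \frac{1}{T^b} + T^{a+b} \in \mathbb{Q}[T,T^{ -1}].$$ Then for every $d \in \{a,b,c\}$, $$P_{|d|}\big(S_{a,b}(T), S_{a,b}(1/T)\big) = -S_{a,b}(1/T^{|d|}).$$ Moreover, if $a$ is even and $b$ is odd, then with $$R_{a,b}(T) = \frac{1}{T^a} + \frac{(-1)^{a+b}}{T^b} + T^{a+b}$$ we have, for every $d \in \{a,b,c\}$, $$P_{|d|}\big(-R_{a,b}(T), -R_{a,b}(1/T)\big) = \begin{cases} -S_{a,b}(1/T^{|d|}), & \text{if } d = a,\\ R_{a,b}(1/T^{|d|}), & \text{if } d \in \{b,c\}.\end{cases}$$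
   Context: All identities are identities of Laurent polynomials in $\mathbb{Q}[T,T^{ -1}]$. -}

module Defs where

open import Data.Bool using (Bool; true; false; if_then_else_)
open import Data.Nat as ℕ using (ℕ; zero; suc; _∸_; _≤ᵇ_)
open import Data.Nat.Combinatorics using (_C_)
open import Data.Integer as ℤ using (ℤ; +_; -[1+_]; ∣_∣)
open import Data.Rational as ℚ using (ℚ; 0ℚ; 1ℚ; _/_)
open import Data.List using (List; []; _∷_; _++_; map; concatMap; foldr)
open import Data.Product using (_×_; _,_)
open import Relation.Nullary.Decidable using (does)
open import Relation.Binary.PropositionalEquality using (_≡_)

-- Laurent polynomials in ℚ[T,T⁻¹], represented as finite formal sums
-- of monomials  c·T^e  (list of (c , e)).  Equality is equality of
-- all coefficients (see _≈L_), so this is exactly ℚ[T,T⁻¹].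

LP : Set
LP = List (ℚ × ℤ)

coeff : LP → ℤ → ℚ
coeff [] n = 0ℚ
coeff ((c , e) ∷ p) n = if does (e ℤ.≟ n) then c ℚ.+ coeff p n else coeff p n

infix 4 _≈L_
_≈L_ : LP → LP → Set
p ≈L q = ∀ n → coeff p n ≡ coeff q n

infixl 6 _+L_
_+L_ : LP → LP → LP
p +L q = p ++ q

infixl 7 _*L_
_*L_ : LP → LP → LP
p *L q = concatMap (λ { (a , m) → map (λ { (b , n) → (a ℚ.* b , m ℤ.+ n) }) q }) p

scaleL : ℚ → LP → LP
scaleL c p = map (λ { (a , m) → (c ℚ.* a , m) }) p

negL : LP → LP
negL = scaleL (ℚ.- 1ℚ)

oneL : LP
oneL = (1ℚ , + 0) ∷ []

_^L_ : LP → ℕ → LP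
p ^L zero = oneL
p ^L suc k = p *L (p ^L k)

-- substitution T ↦ T^m  (m : ℤ);  e.g. m = -1 gives f(1/T)
substPow : LP → ℤ → LP
substPow p m = map (λ { (a , e) → (a , e ℤ.* m) }) p

-- The polynomial P_d(X,Y) as a list of terms  (coefficient , k , j)
-- standing for  coefficient · X^k · Y^j.

-- (-1)^(k-1) for k ∈ ℕ (so k = 0 gives -1)
signPred : ℕ → ℤ
signPred zero = -[1+ 0 ]
signPred (suc zero) = + 1
signPred (suc (suc k)) = signPred k

-- rational division n / m; the case m = 0 never occurs in P_d for d ≥ 1
divℚ : ℤ → ℕ → ℚ
divℚ n zero = 0ℚ
divℚ n (suc m) = n / suc m

range : ℕ → List ℕ
range zero = []
range (suc n) = range n ++ (n ∷ [])

Pcoef : ℕ → ℕ → ℕ → ℚ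
Pcoef d k l =
  divℚ (+ d ℤ.* signPred k ℤ.* + ((k ℕ.+ l) C k) ℤ.* + ((d ∸ k ∸ 2 ℕ.* l) C (k ℕ.+ l)))
       (d ∸ k ∸ 2 ℕ.* l)

P : ℕ → List (ℚ × ℕ × ℕ)
P d = concatMap (λ k → concatMap (λ l →
        if (2 ℕ.* k ℕ.+ 3 ℕ.* l) ≤ᵇ d
          then (Pcoef d k l , k , (d ∸ 2 ℕ.* k ∸ 3 ℕ.* l)) ∷ []
          else []) (range (suc d))) (range (suc d))

evalP : List (ℚ × ℕ × ℕ) → LP → LP → LP
evalP [] X Y = []
evalP ((c , k , j) ∷ t) X Y = scaleL c ((X ^L k) *L (Y ^L j)) +L evalP t X Y

S : ℤ → ℤ → LP
S a b = (1ℚ , ℤ.- a) ∷ (1ℚ , ℤ.- b) ∷ (1ℚ , a ℤ.+ b) ∷ []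

negOnePow : ℤ → ℚ
negOnePow n = if does (∣ n ∣ ℕ.% 2 ℕ.≟ 0) then 1ℚ else ℚ.- 1ℚ

R : ℤ → ℤ → LP
R a b = (1ℚ , ℤ.- a) ∷ (negOnePow (a ℤ.+ b) , ℤ.- b) ∷ (1ℚ , a ℤ.+ b) ∷ []

{-# OPTIONS --safe #-}
-- Put x = T^a, y = T^b, z = T^-(a+b), so that xyz = 1.  Their elementary symmetric functions are
-- e₁ = S(1/T) and e₂ = S(T), and their power sums are p_d = S(1/T^d).  Replacing x, z by -x, -z
-- gives e₁ = -R(1/T) and e₂ = -R(T) when a + b is odd, while -p_d becomes -S(1/T^d) for even d
-- and R(1/T^d) for odd d; here a is even and b, a + b are odd.  So both statements are the
-- Girard–Waring identity P_d(e₂, e₁) = -p_d for three variables with e₃ = 1.  It holds in any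
-- commutative ring in homogeneous form, e₃ getting weight 3: the coefficients
-- (-1)^(k-1) d (k+l+j-1)! / (k! l! j!) of e₂^k e₃^l e₁^j satisfy a Pascal-type recurrence, so these
-- forms obey Newton's recurrence Q_d = e₁ Q_(d-1) - e₂ Q_(d-2) + e₃ Q_(d-3) for d ≥ 4, just as -p_d
-- does; degrees 1, 2, 3 are checked directly.
module Submission where

open import Algebra.Bundles using (CommutativeRing)
open import Algebra.Morphism.Structures using (module RingMorphisms)
open import Data.Integer as ℤ using (ℤ)

module Shift {A : Set} (0A : A) where

  open import Data.Nat using (ℕ; zero; suc)

  ↓j ↓k ↓l : (ℕ → ℕ → ℕ → A) → ℕ → ℕ → ℕ → A
  ↓j F k l zero    = 0A
  ↓j F k l (suc j) = F k l j
  ↓k F zero    l j = 0A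
  ↓k F (suc k) l j = F k l j
  ↓l F k zero    j = 0A
  ↓l F k (suc l) j = F k l j

module Multinomial where

  open import Data.Nat
  open import Data.Nat.Properties
  open import Data.Nat.Combinatorics
  open import Data.Nat.Tactic.RingSolver using (solve-∀)
  open import Algebra.Properties.CommutativeSemigroup *-commutativeSemigroup using (x∙yz≈y∙xz; x∙yz≈yx∙z; xy∙z≈x∙zy)
  open import Relation.Binary.PropositionalEquality
  open ≡-Reasoning

  open Shift 0 public

  [1+n]C[1+k]≡nCk+nC[1+k] : ∀ n k → suc n C suc k ≡ n C k + n C suc k
  [1+n]C[1+k]≡nCk+nC[1+k] n k = sym (nCk+nC[k+1]≡[n+1]C[k+1] n k)

  [m+n]Cm≡[m+n]Cn : ∀ m n → (m + n) C m ≡ (m + n) C n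
  [m+n]Cm≡[m+n]Cn m n = begin
    (m + n) C m              ≡⟨ nCk≡nC[n∸k] (m≤m+n m n) ⟩
    (m + n) C (m + n ∸ m)    ≡⟨ cong ((m + n) C_) (m+n∸m≡n m n) ⟩
    (m + n) C n              ∎

  [1+k]*[1+n]C[1+k]≡[1+n]*nCk : ∀ n k → suc k * (suc n C suc k) ≡ suc n * (n C k)
  [1+k]*[1+n]C[1+k]≡[1+n]*nCk zero    zero    = refl
  [1+k]*[1+n]C[1+k]≡[1+n]*nCk zero    (suc k) = *-zeroʳ (suc (suc k))
  [1+k]*[1+n]C[1+k]≡[1+n]*nCk (suc n) zero    = trans (+-identityʳ _) (trans (nC1≡n (suc (suc n))) (sym (*-identityʳ _)))
  [1+k]*[1+n]C[1+k]≡[1+n]*nCk (suc n) (suc k) = begin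
    suc (suc k) * (suc (suc n) C suc (suc k))
      ≡⟨ cong (suc (suc k) *_) ([1+n]C[1+k]≡nCk+nC[1+k] (suc n) (suc k)) ⟩
    suc (suc k) * (suc n C suc k + suc n C suc (suc k))
      ≡⟨ *-distribˡ-+ (suc (suc k)) (suc n C suc k) _ ⟩
    suc n C suc k + suc k * (suc n C suc k) + suc (suc k) * (suc n C suc (suc k))
      ≡⟨ cong₂ (λ x y → suc n C suc k + x + y) ([1+k]*[1+n]C[1+k]≡[1+n]*nCk n k) ([1+k]*[1+n]C[1+k]≡[1+n]*nCk n (suc k)) ⟩
    suc n C suc k + suc n * (n C k) + suc n * (n C suc k)
      ≡⟨ cong (λ x → x + suc n * (n C k) + suc n * (n C suc k)) ([1+n]C[1+k]≡nCk+nC[1+k] n k) ⟩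
    n C k + n C suc k + suc n * (n C k) + suc n * (n C suc k)
      ≡⟨ regroup (n C k) (n C suc k) n ⟩
    suc (suc n) * (n C k + n C suc k)
      ≡⟨ cong (suc (suc n) *_) ([1+n]C[1+k]≡nCk+nC[1+k] n k) ⟨
    suc (suc n) * (suc n C suc k) ∎
    where
    regroup : ∀ x y m → x + y + suc m * x + suc m * y ≡ suc (suc m) * (x + y)
    regroup = solve-∀

  [k+0]Ck≡1 : ∀ k → (k + 0) C k ≡ 1
  [k+0]Ck≡1 k = trans (cong (_C k) (+-identityʳ k)) (nCn≡1 k)

  [1+m]*[1+m+j]Cj≡[1+m+j]*[m+j]Cj : ∀ m j → suc m * ((suc m + j) C j) ≡ (suc m + j) * ((m + j) C j)
  [1+m]*[1+m+j]Cj≡[1+m+j]*[m+j]Cj m j = begin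
    suc m * ((suc m + j) C j)       ≡⟨ cong (suc m *_) ([m+n]Cm≡[m+n]Cn (suc m) j) ⟨
    suc m * ((suc m + j) C suc m)   ≡⟨ [1+k]*[1+n]C[1+k]≡[1+n]*nCk (m + j) m ⟩
    suc (m + j) * ((m + j) C m)     ≡⟨ cong (suc (m + j) *_) ([m+n]Cm≡[m+n]Cn m j) ⟩
    (suc m + j) * ((m + j) C j)     ∎

  weight : ℕ → ℕ → ℕ
  weight k l = 2 * k + 3 * l

  size degree : ℕ → ℕ → ℕ → ℕ
  size   k l j = k + l + j
  degree k l j = weight k l + j

  k≤weight : ∀ k l → k ≤ weight k l
  k≤weight k l = ≤-trans (m≤m+n k (k + 0)) (m≤m+n (2 * k) (3 * l))

  l≤weight : ∀ k l → l ≤ weight k l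
  l≤weight k l = ≤-trans (m≤m+n l (2 * l)) (m≤n+m (3 * l) (2 * k))

  j≤degree : ∀ k l j → j ≤ degree k l j
  j≤degree k l j = m≤n+m j (weight k l)

  degree∸weight : ∀ k l j → degree k l j ∸ 2 * k ∸ 3 * l ≡ j
  degree∸weight k l j = trans (∸-+-assoc (degree k l j) (2 * k) (3 * l)) (m+n∸m≡n (weight k l) j)

  degree-complement : ∀ d k l → weight k l ≤ d → degree k l (d ∸ 2 * k ∸ 3 * l) ≡ d
  degree-complement d k l w≤d = trans (cong (weight k l +_) (∸-+-assoc d (2 * k) (3 * l))) (m+[n∸m]≡n w≤d)

  degree-sucʲ : ∀ k l j → degree k l (suc j) ≡ 1 + degree k l j
  degree-sucʲ k l j = +-suc (2 * k + 3 * l) j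

  degree-sucᵏ : ∀ k l j → degree (suc k) l j ≡ 2 + degree k l j
  degree-sucᵏ = expand
    where
    expand : ∀ k l j → 2 * suc k + 3 * l + j ≡ 2 + (2 * k + 3 * l + j)
    expand = solve-∀

  degree-sucˡ : ∀ k l j → degree k (suc l) j ≡ 3 + degree k l j
  degree-sucˡ = expand
    where
    expand : ∀ k l j → 2 * k + 3 * suc l + j ≡ 3 + (2 * k + 3 * l + j)
    expand = solve-∀

  0<size : ∀ k l j → 0 < degree k l j → 0 < size k l j
  0<size (suc k) l       j       _ = s≤s z≤n
  0<size zero    (suc l) j       _ = s≤s z≤n
  0<size zero    zero    (suc j) _ = s≤s z≤n

  multinomial : ℕ → ℕ → ℕ → ℕ
  multinomial k l j = ((k + l + j) C j) * ((k + l) C k)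

  PascalAt : (ℕ → ℕ → ℕ → ℕ) → ℕ → ℕ → ℕ → Set
  PascalAt F k l j = F k l j ≡ ↓j F k l j + ↓k F k l j + ↓l F k l j

  private
    C[1+j]-split : ∀ k l j → ((k + l + j) C suc j) * ((k + l) C k)
                            ≡ ↓k multinomial k l (suc j) + ↓l multinomial k l (suc j)
    C[1+j]-split zero    zero    j = cong (_* 1) (k>n⇒nCk≡0 (n<1+n j))
    C[1+j]-split (suc k) zero    j = begin
      ((suc k + 0 + j) C suc j) * ((suc k + 0) C suc k)
        ≡⟨ cong₂ _*_ (cong (_C suc j) (sym (+-suc (k + 0) j))) (trans ([k+0]Ck≡1 (suc k)) (sym ([k+0]Ck≡1 k))) ⟩
      multinomial k 0 (suc j)
        ≡⟨ +-identityʳ _ ⟨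
      multinomial k 0 (suc j) + 0 ∎
    C[1+j]-split zero    (suc l) j = cong (λ n → (n C suc j) * 1) (sym (+-suc l j))
    C[1+j]-split (suc k) (suc l) j = begin
      (N C suc j) * ((suc k + suc l) C suc k)
        ≡⟨ cong ((N C suc j) *_) ([1+n]C[1+k]≡nCk+nC[1+k] (k + suc l) k) ⟩
      (N C suc j) * ((k + suc l) C k + (k + suc l) C suc k)
        ≡⟨ *-distribˡ-+ (N C suc j) _ _ ⟩
      (N C suc j) * ((k + suc l) C k) + (N C suc j) * ((k + suc l) C suc k)
        ≡⟨ cong₂ _+_ (cong (λ n → (n C suc j) * ((k + suc l) C k)) (shift₁ k l j))
                     (cong₂ (λ n m → (n C suc j) * (m C suc k)) (shift₂ k l j) (+-suc k l)) ⟩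
      multinomial k (suc l) (suc j) + multinomial (suc k) l (suc j) ∎
      where
      N = suc k + suc l + j
      shift₁ : ∀ k l j → suc k + suc l + j ≡ k + suc l + suc j
      shift₁ = solve-∀
      shift₂ : ∀ k l j → suc k + suc l + j ≡ suc k + l + suc j
      shift₂ = solve-∀

  multinomial-pascal : ∀ k l j → 0 < size k l j → PascalAt multinomial k l j
  multinomial-pascal k l (suc j) _ = begin
    ((k + l + suc j) C suc j) * ((k + l) C k)
      ≡⟨ cong (_* ((k + l) C k)) (trans (cong (_C suc j) (+-suc (k + l) j)) ([1+n]C[1+k]≡nCk+nC[1+k] (k + l + j) j)) ⟩
    ((k + l + j) C j + (k + l + j) C suc j) * ((k + l) C k)
      ≡⟨ *-distribʳ-+ ((k + l) C k) ((k + l + j) C j) _ ⟩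
    multinomial k l j + ((k + l + j) C suc j) * ((k + l) C k)
      ≡⟨ cong (multinomial k l j +_) (C[1+j]-split k l j) ⟩
    multinomial k l j + (↓k multinomial k l (suc j) + ↓l multinomial k l (suc j))
      ≡⟨ +-assoc (multinomial k l j) _ _ ⟨
    multinomial k l j + ↓k multinomial k l (suc j) + ↓l multinomial k l (suc j) ∎
  multinomial-pascal (suc k) zero    zero _ = begin
    1 * ((suc k + 0) C suc k)    ≡⟨ cong (1 *_) (trans ([k+0]Ck≡1 (suc k)) (sym ([k+0]Ck≡1 k))) ⟩
    1 * ((k + 0) C k)            ≡⟨ +-identityʳ _ ⟨
    1 * ((k + 0) C k) + 0        ∎
  multinomial-pascal zero    (suc l) zero _ = refl
  multinomial-pascal (suc k) (suc l) zero _ = begin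
    1 * ((suc k + suc l) C suc k)
      ≡⟨ cong (1 *_) ([1+n]C[1+k]≡nCk+nC[1+k] (k + suc l) k) ⟩
    1 * ((k + suc l) C k + (k + suc l) C suc k)
      ≡⟨ *-distribˡ-+ 1 ((k + suc l) C k) _ ⟩
    1 * ((k + suc l) C k) + 1 * ((k + suc l) C suc k)
      ≡⟨ cong (λ n → 1 * ((k + suc l) C k) + 1 * (n C suc k)) (+-suc k l) ⟩
    1 * ((k + suc l) C k) + 1 * ((suc k + l) C suc k) ∎

  multinomial-absorptionᵏ : ∀ k l j → k * multinomial k l j ≡ size k l j * ↓k multinomial k l j
  multinomial-absorptionᵏ zero    l j = sym (*-zeroʳ (l + j))
  multinomial-absorptionᵏ (suc k) l j = begin
    suc k * (A * ((suc k + l) C suc k))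
      ≡⟨ x∙yz≈y∙xz (suc k) A _ ⟩
    A * (suc k * ((suc k + l) C suc k))
      ≡⟨ cong (A *_) ([1+k]*[1+n]C[1+k]≡[1+n]*nCk (k + l) k) ⟩
    A * (suc (k + l) * ((k + l) C k))
      ≡⟨ x∙yz≈yx∙z A (suc (k + l)) _ ⟩
    suc (k + l) * A * ((k + l) C k)
      ≡⟨ cong (_* ((k + l) C k)) ([1+m]*[1+m+j]Cj≡[1+m+j]*[m+j]Cj (k + l) j) ⟩
    (suc k + l + j) * ((k + l + j) C j) * ((k + l) C k)
      ≡⟨ *-assoc (suc k + l + j) ((k + l + j) C j) ((k + l) C k) ⟩
    size (suc k) l j * multinomial k l j ∎
    where
    A = (suc k + l + j) C j

  multinomial-absorptionˡ : ∀ k l j → l * multinomial k l j ≡ size k l j * ↓l multinomial k l j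
  multinomial-absorptionˡ k zero    j = sym (*-zeroʳ (k + 0 + j))
  multinomial-absorptionˡ k (suc l) j = begin
    suc l * (A * ((k + suc l) C k))
      ≡⟨ x∙yz≈y∙xz (suc l) A _ ⟩
    A * (suc l * ((k + suc l) C k))
      ≡⟨ cong (A *_) lower ⟩
    A * ((k + suc l) * ((k + l) C k))
      ≡⟨ x∙yz≈yx∙z A (k + suc l) _ ⟩
    (k + suc l) * A * ((k + l) C k)
      ≡⟨ cong (λ n → n * ((n + j) C j) * ((k + l) C k)) (+-suc k l) ⟩
    suc (k + l) * ((suc (k + l) + j) C j) * ((k + l) C k)
      ≡⟨ cong (_* ((k + l) C k)) ([1+m]*[1+m+j]Cj≡[1+m+j]*[m+j]Cj (k + l) j) ⟩
    (suc (k + l) + j) * ((k + l + j) C j) * ((k + l) C k)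
      ≡⟨ *-assoc (suc (k + l) + j) ((k + l + j) C j) ((k + l) C k) ⟩
    (suc (k + l) + j) * multinomial k l j
      ≡⟨ cong (λ n → (n + j) * multinomial k l j) (+-suc k l) ⟨
    size k (suc l) j * multinomial k l j ∎
    where
    A = (k + suc l + j) C j
    lower : suc l * ((k + suc l) C k) ≡ (k + suc l) * ((k + l) C k)
    lower = begin
      suc l * ((k + suc l) C k)     ≡⟨ cong (λ n → suc l * (n C k)) (+-comm k (suc l)) ⟩
      suc l * ((suc l + k) C k)     ≡⟨ [1+m]*[1+m+j]Cj≡[1+m+j]*[m+j]Cj l k ⟩
      (suc l + k) * ((l + k) C k)   ≡⟨ cong₂ (λ n m → n * (m C k)) (+-comm (suc l) k) (+-comm l k) ⟩
      (k + suc l) * ((k + l) C k)   ∎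

  -- waring k l j = degree k l j · (k + l + j - 1)! / (k! l! j!)
  waring : ℕ → ℕ → ℕ → ℕ
  waring k l j = multinomial k l j + ↓k multinomial k l j + 2 * ↓l multinomial k l j

  degree*multinomial≡size*waring : ∀ k l j → degree k l j * multinomial k l j ≡ size k l j * waring k l j
  degree*multinomial≡size*waring k l j = begin
    degree k l j * M
      ≡⟨ expand k l j M ⟩
    n * M + k * M + 2 * (l * M)
      ≡⟨ cong₂ (λ x y → n * M + x + 2 * y) (multinomial-absorptionᵏ k l j) (multinomial-absorptionˡ k l j) ⟩
    n * M + n * ↓k multinomial k l j + 2 * (n * ↓l multinomial k l j)
      ≡⟨ collect n M (↓k multinomial k l j) (↓l multinomial k l j) ⟩
    n * waring k l j ∎
    where
    M = multinomial k l j
    n = size k l j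
    expand : ∀ k l j M → (2 * k + 3 * l + j) * M ≡ (k + l + j) * M + k * M + 2 * (l * M)
    expand = solve-∀
    collect : ∀ n x y z → n * x + n * y + 2 * (n * z) ≡ n * (x + y + 2 * z)
    collect = solve-∀

  private
    Combination : (F G H : ℕ → ℕ → ℕ → ℕ) → ℕ → ℕ → ℕ → ℕ
    Combination F G H k l j = F k l j + G k l j + 2 * H k l j

    ↓j-combination : ∀ F G H k l j → ↓j (Combination F G H) k l j ≡ Combination (↓j F) (↓j G) (↓j H) k l j
    ↓j-combination F G H k l zero    = refl
    ↓j-combination F G H k l (suc j) = refl

    ↓k-combination : ∀ F G H k l j → ↓k (Combination F G H) k l j ≡ Combination (↓k F) (↓k G) (↓k H) k l j
    ↓k-combination F G H zero    l j = refl
    ↓k-combination F G H (suc k) l j = refl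

    ↓l-combination : ∀ F G H k l j → ↓l (Combination F G H) k l j ≡ Combination (↓l F) (↓l G) (↓l H) k l j
    ↓l-combination F G H k zero    j = refl
    ↓l-combination F G H k (suc l) j = refl

    pascal-combination : ∀ F G H k l j → PascalAt F k l j → PascalAt G k l j → PascalAt H k l j →
                         PascalAt (Combination F G H) k l j
    pascal-combination F G H k l j pF pG pH = begin
      F k l j + G k l j + 2 * H k l j
        ≡⟨ cong₂ _+_ (cong₂ _+_ pF pG) (cong (2 *_) pH) ⟩
      (jF + kF + lF) + (jG + kG + lG) + 2 * (jH + kH + lH)
        ≡⟨ regroup jF kF lF jG kG lG jH kH lH ⟩
      (jF + jG + 2 * jH) + (kF + kG + 2 * kH) + (lF + lG + 2 * lH)
        ≡⟨ cong₂ _+_ (cong₂ _+_ (↓j-combination F G H k l j) (↓k-combination F G H k l j))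
                     (↓l-combination F G H k l j) ⟨
      ↓j (Combination F G H) k l j + ↓k (Combination F G H) k l j + ↓l (Combination F G H) k l j ∎
      where
      jF = ↓j F k l j ; kF = ↓k F k l j ; lF = ↓l F k l j
      jG = ↓j G k l j ; kG = ↓k G k l j ; lG = ↓l G k l j
      jH = ↓j H k l j ; kH = ↓k H k l j ; lH = ↓l H k l j
      regroup : ∀ a b c d e f g h i → (a + b + c) + (d + e + f) + 2 * (g + h + i)
                                     ≡ (a + d + 2 * g) + (b + e + 2 * h) + (c + f + 2 * i)
      regroup = solve-∀

    pascal-↓k : ∀ F k l j → PascalAt F k l j → PascalAt (↓k F) (suc k) l j
    pascal-↓k F k zero    zero    p = p
    pascal-↓k F k zero    (suc j) p = p
    pascal-↓k F k (suc l) zero    p = p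
    pascal-↓k F k (suc l) (suc j) p = p

    pascal-↓l : ∀ F k l j → PascalAt F k l j → PascalAt (↓l F) k (suc l) j
    pascal-↓l F zero    l zero    p = p
    pascal-↓l F zero    l (suc j) p = p
    pascal-↓l F (suc k) l zero    p = p
    pascal-↓l F (suc k) l (suc j) p = p

    pascal-↓k-zero : ∀ F l j → PascalAt (↓k F) zero l j
    pascal-↓k-zero F zero    zero    = refl
    pascal-↓k-zero F zero    (suc j) = refl
    pascal-↓k-zero F (suc l) zero    = refl
    pascal-↓k-zero F (suc l) (suc j) = refl

    pascal-↓l-zero : ∀ F k j → PascalAt (↓l F) k zero j
    pascal-↓l-zero F zero    zero    = refl
    pascal-↓l-zero F zero    (suc j) = refl
    pascal-↓l-zero F (suc k) zero    = refl
    pascal-↓l-zero F (suc k) (suc j) = refl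

  waring-pascal : ∀ k l j → 4 ≤ degree k l j → PascalAt waring k l j
  waring-pascal k l j 4≤d =
    pascal-combination multinomial (↓k multinomial) (↓l multinomial) k l j
      (multinomial-pascal k l j (0<size k l j (≤-trans (s≤s z≤n) 4≤d))) (↓k-pascal k 4≤d) (↓l-pascal l 4≤d)
    where
    ↓k-pascal : ∀ k → 4 ≤ degree k l j → PascalAt (↓k multinomial) k l j
    ↓k-pascal zero _ = pascal-↓k-zero multinomial l j
    ↓k-pascal (suc k) 4≤d = pascal-↓k multinomial k l j (multinomial-pascal k l j (0<size k l j 0<d))
      where
      0<d : 0 < degree k l j
      0<d = ≤-trans (s≤s z≤n) (≤-pred (≤-pred (subst (4 ≤_) (degree-sucᵏ k l j) 4≤d)))
    ↓l-pascal : ∀ l → 4 ≤ degree k l j → PascalAt (↓l multinomial) k l j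
    ↓l-pascal zero _ = pascal-↓l-zero multinomial k j
    ↓l-pascal (suc l) 4≤d = pascal-↓l multinomial k l j (multinomial-pascal k l j (0<size k l j 0<d))
      where
      0<d : 0 < degree k l j
      0<d = ≤-pred (≤-pred (≤-pred (subst (4 ≤_) (degree-sucˡ k l j) 4≤d)))

  degree*C*C≡size*waring : ∀ k l j → degree k l j * ((k + l) C k) * (size k l j C (k + l)) ≡ size k l j * waring k l j
  degree*C*C≡size*waring k l j = begin
    degree k l j * ((k + l) C k) * (size k l j C (k + l))
      ≡⟨ cong (degree k l j * ((k + l) C k) *_) ([m+n]Cm≡[m+n]Cn (k + l) j) ⟩
    degree k l j * ((k + l) C k) * (size k l j C j)
      ≡⟨ xy∙z≈x∙zy (degree k l j) ((k + l) C k) (size k l j C j) ⟩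
    degree k l j * multinomial k l j
      ≡⟨ degree*multinomial≡size*waring k l j ⟩
    size k l j * waring k l j ∎

module Coefficients where

  open import Data.Bool using (true; false; if_then_else_; T)
  open import Data.Nat as ℕ using (ℕ; zero; suc; _≤_)
  import Data.Nat.Properties as ℕ
  open import Data.Integer using (ℤ; +_; -_; _+_; _-_; _*_)
  import Data.Integer.Properties as ℤ
  open import Data.Integer.Tactic.RingSolver using (solve-∀)
  open import Data.Empty using (⊥-elim)
  open import Relation.Nullary using (contradiction)
  open import Relation.Binary.PropositionalEquality
  open ≡-Reasoning

  open import Defs using (signPred)
  open Multinomial using (degree; waring; waring-pascal; degree-sucʲ; degree-sucᵏ; degree-sucˡ)
  open Shift (+ 0)

  waringCoefficient : ℕ → ℕ → ℕ → ℤ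
  waringCoefficient k l j = signPred k * + waring k l j

  component : ℕ → (ℕ → ℕ → ℕ → ℤ) → ℕ → ℕ → ℕ → ℤ
  component d c k l j = if degree k l j ℕ.≡ᵇ d then c k l j else + 0

  component-on : ∀ d c k l j → degree k l j ≡ d → component d c k l j ≡ c k l j
  component-on d c k l j deg≡d with degree k l j ℕ.≡ᵇ d in deg≡ᵇd
  ... | true  = refl
  ... | false = ⊥-elim (subst T deg≡ᵇd (ℕ.≡⇒≡ᵇ (degree k l j) d deg≡d))

  component-off : ∀ d c k l j → degree k l j ≢ d → component d c k l j ≡ + 0
  component-off d c k l j deg≢d with degree k l j ℕ.≡ᵇ d in deg≡ᵇd
  ... | true  = contradiction (ℕ.≡ᵇ⇒≡ (degree k l j) d (subst T (sym deg≡ᵇd) _)) deg≢d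
  ... | false = refl

  private
    if-zero : ∀ b → (if b then + 0 else + 0) ≡ + 0
    if-zero true  = refl
    if-zero false = refl

    guard-cong : ∀ {m n} d (x : ℤ) → m ≡ n → (if m ℕ.≡ᵇ d then x else + 0) ≡ (if n ℕ.≡ᵇ d then x else + 0)
    guard-cong d x refl = refl

  ↓j-component : ∀ d c k l j → ↓j (component d c) k l j ≡ component (suc d) (↓j c) k l j
  ↓j-component d c k l zero    = sym (if-zero _)
  ↓j-component d c k l (suc j) = guard-cong (suc d) (c k l j) (sym (degree-sucʲ k l j))

  ↓k-component : ∀ d c k l j → ↓k (component d c) k l j ≡ component (2 ℕ.+ d) (↓k c) k l j
  ↓k-component d c zero    l j = sym (if-zero _)
  ↓k-component d c (suc k) l j = guard-cong (2 ℕ.+ d) (c k l j) (sym (degree-sucᵏ k l j))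

  ↓l-component : ∀ d c k l j → ↓l (component d c) k l j ≡ component (3 ℕ.+ d) (↓l c) k l j
  ↓l-component d c k zero    j = sym (if-zero _)
  ↓l-component d c k (suc l) j = guard-cong (3 ℕ.+ d) (c k l j) (sym (degree-sucˡ k l j))

  signPred-suc : ∀ k → signPred (suc k) ≡ - signPred k
  signPred-suc zero          = refl
  signPred-suc (suc zero)    = refl
  signPred-suc (suc (suc k)) = signPred-suc k

  private
    ↓j-waringCoefficient : ∀ k l j → ↓j waringCoefficient k l j ≡ signPred k * + Multinomial.↓j waring k l j
    ↓j-waringCoefficient k l zero    = sym (ℤ.*-zeroʳ (signPred k))
    ↓j-waringCoefficient k l (suc j) = refl

    ↓k-waringCoefficient : ∀ k l j → ↓k waringCoefficient k l j ≡ - (signPred k * + Multinomial.↓k waring k l j)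
    ↓k-waringCoefficient zero    l j = refl
    ↓k-waringCoefficient (suc k) l j = begin
      signPred k * + waring k l j            ≡⟨ cong (_* + waring k l j) (ℤ.neg-involutive (signPred k)) ⟨
      - - signPred k * + waring k l j        ≡⟨ cong (λ s → - s * + waring k l j) (signPred-suc k) ⟨
      - signPred (suc k) * + waring k l j    ≡⟨ ℤ.neg-distribˡ-* (signPred (suc k)) _ ⟨
      - (signPred (suc k) * + waring k l j)  ∎

    ↓l-waringCoefficient : ∀ k l j → ↓l waringCoefficient k l j ≡ signPred k * + Multinomial.↓l waring k l j
    ↓l-waringCoefficient k zero    j = sym (ℤ.*-zeroʳ (signPred k))
    ↓l-waringCoefficient k (suc l) j = refl

  waringCoefficient-recurrence : ∀ k l j → 4 ≤ degree k l j →
    waringCoefficient k l j ≡ ↓j waringCoefficient k l j - ↓k waringCoefficient k l j + ↓l waringCoefficient k l j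
  waringCoefficient-recurrence k l j 4≤deg = begin
    s * + waring k l j
      ≡⟨ cong (λ w → s * + w) (waring-pascal k l j 4≤deg) ⟩
    s * + (wj ℕ.+ wk ℕ.+ wl)
      ≡⟨ cong (s *_) (trans (ℤ.pos-+ (wj ℕ.+ wk) wl) (cong (λ x → x + + wl) (ℤ.pos-+ wj wk))) ⟩
    s * (+ wj + + wk + + wl)
      ≡⟨ distribute s (+ wj) (+ wk) (+ wl) ⟩
    s * + wj - - (s * + wk) + s * + wl
      ≡⟨ cong₂ (λ x y → x - y + s * + wl) (↓j-waringCoefficient k l j) (↓k-waringCoefficient k l j) ⟨
    ↓j waringCoefficient k l j - ↓k waringCoefficient k l j + s * + wl
      ≡⟨ cong (λ x → ↓j waringCoefficient k l j - ↓k waringCoefficient k l j + x) (↓l-waringCoefficient k l j) ⟨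
    ↓j waringCoefficient k l j - ↓k waringCoefficient k l j + ↓l waringCoefficient k l j ∎
    where
    s  = signPred k
    wj = Multinomial.↓j waring k l j
    wk = Multinomial.↓k waring k l j
    wl = Multinomial.↓l waring k l j
    distribute : ∀ s a b c → s * (a + b + c) ≡ s * a - - (s * b) + s * c
    distribute = solve-∀

  component-recurrence : ∀ e k l j →
    component (4 ℕ.+ e) waringCoefficient k l j
      ≡ ↓j (component (3 ℕ.+ e) waringCoefficient) k l j - ↓k (component (2 ℕ.+ e) waringCoefficient) k l j
        + ↓l (component (1 ℕ.+ e) waringCoefficient) k l j
  component-recurrence e k l j
    rewrite ↓j-component (3 ℕ.+ e) waringCoefficient k l j
          | ↓k-component (2 ℕ.+ e) waringCoefficient k l j
          | ↓l-component (1 ℕ.+ e) waringCoefficient k l j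
    with degree k l j ℕ.≡ᵇ 4 ℕ.+ e in deg≡ᵇ4+e
  ... | true  = waringCoefficient-recurrence k l j
                  (ℕ.≤-trans (ℕ.m≤m+n 4 e) (ℕ.≤-reflexive (sym deg≡4+e)))
    where
    deg≡4+e : degree k l j ≡ 4 ℕ.+ e
    deg≡4+e = ℕ.≡ᵇ⇒≡ (degree k l j) _ (subst T (sym deg≡ᵇ4+e) _)
  ... | false = refl

module WaringForm {a} {A : Set a} (_+_ _*_ : A → A → A) (ι : ℤ → A) where

  open import Data.Integer using (+_)
  open import Data.Bool using (if_then_else_)
  open import Data.Nat as ℕ using (ℕ; zero; suc; _∸_; _≤ᵇ_)
  open Multinomial using (weight)
  open Coefficients using (waringCoefficient)

  pow : A → ℕ → A
  pow x zero    = ι (+ 1)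
  pow x (suc n) = x * pow x n

  sum : ℕ → (ℕ → A) → A
  sum zero    f = ι (+ 0)
  sum (suc n) f = sum n f + f n

  term : (ℕ → ℕ → ℕ → ℤ) → A → A → A → ℕ → ℕ → ℕ → A
  term c X Y Z k l j = ι (c k l j) * (pow X k * (pow Z l * pow Y j))

  waringTerm : ℕ → A → A → A → ℕ → ℕ → A
  waringTerm d X Y Z k l =
    if weight k l ≤ᵇ d then term waringCoefficient X Y Z k l (d ∸ 2 ℕ.* k ∸ 3 ℕ.* l) else ι (+ 0)

  -- The homogenisation of the paper's P_d, with X, Y, Z of weights 2, 1, 3: P_d(X, Y) = waringForm d X Y 1.
  waringForm : ℕ → A → A → A → A
  waringForm d X Y Z = sum (suc d) λ k → sum (suc d) λ l → waringTerm d X Y Z k l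

  e₁ e₂ e₃ : A → A → A → A
  e₁ x y z = (x + y) + z
  e₂ x y z = ((x * y) + (x * z)) + (y * z)
  e₃ x y z = (x * y) * z

  powerSum : ℕ → A → A → A → A
  powerSum d x y z = (pow x d + pow y d) + pow z d

module GirardWaring {c ℓ} (R : CommutativeRing c ℓ) {ι : ℤ → CommutativeRing.Carrier R}
  (ι-isRingHomomorphism : RingMorphisms.IsRingHomomorphism ℤ.+-*-rawRing (CommutativeRing.rawRing R) ι)
  where

  open import Data.Integer using (+_)
  open import Data.Nat as ℕ using (ℕ; zero; suc; _≤_; _<_; s≤s; _∸_; _≤ᵇ_)
  import Data.Nat.Properties as ℕ
  open import Data.Sum using (inj₁; inj₂)
  open import Function using (_∘_)
  open import Data.Product using (_×_)
  open import Data.Maybe using (Maybe; just; nothing)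
  open import Relation.Nullary using (yes; no; contradiction)
  open import Data.Bool using (T; true; false)
  open import Relation.Binary.PropositionalEquality as ≡ using (_≡_; _≢_; subst)
  open import Algebra.Solver.Ring.AlmostCommutativeRing using (fromCommutativeRing; _-Raw-AlmostCommutative⟶_)

  open CommutativeRing R
  open import Algebra.Properties.Ring ring using (-‿distribˡ-*)
  open RingMorphisms.IsRingHomomorphism ι-isRingHomomorphism
    using (+-homo; *-homo; -‿homo; 0#-homo; 1#-homo)
  open import Relation.Binary.Reasoning.Setoid setoid
  open Shift (+ 0)
  open Multinomial using (weight; degree; k≤weight; l≤weight; j≤degree; degree∸weight; degree-complement)
  open Coefficients using (waringCoefficient; component; component-on; component-off; component-recurrence)
  open WaringForm _+_ _*_ ι public

  private
    ι-morphism : ℤ.+-*-rawRing -Raw-AlmostCommutative⟶ fromCommutativeRing R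
    ι-morphism = record
      { ⟦_⟧ = ι ; +-homo = +-homo ; *-homo = *-homo ; -‿homo = -‿homo ; 0-homo = 0#-homo ; 1-homo = 1#-homo }

    ι-≟ : ∀ m n → Maybe (ι m ≈ ι n)
    ι-≟ m n with m ℤ.≟ n
    ... | yes ≡.refl = just refl
    ... | no _       = nothing

  open import Algebra.Solver.Ring ℤ.+-*-rawRing (fromCommutativeRing R) ι-morphism ι-≟

  sum-cong : ∀ n {f g : ℕ → Carrier} → (∀ i → f i ≈ g i) → sum n f ≈ sum n g
  sum-cong zero    f≈g = refl
  sum-cong (suc n) f≈g = +-cong (sum-cong n f≈g) (f≈g n)

  sum-zero : ∀ n {f : ℕ → Carrier} → (∀ i → i < n → f i ≈ 0#) → sum n f ≈ 0#
  sum-zero zero    f≈0 = 0#-homo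
  sum-zero (suc n) f≈0 = begin
    sum n _ + _  ≈⟨ +-cong (sum-zero n (λ i i<n → f≈0 i (ℕ.m<n⇒m<1+n i<n))) (f≈0 n ℕ.≤-refl) ⟩
    0# + 0#      ≈⟨ +-identityˡ 0# ⟩
    0#           ∎

  sum-+ : ∀ n (f g : ℕ → Carrier) → sum n (λ i → f i + g i) ≈ sum n f + sum n g
  sum-+ zero    f g = solve 0 (con (+ 0) := con (+ 0) :+ con (+ 0)) refl
  sum-+ (suc n) f g = trans (+-cong (sum-+ n f g) refl)
    (solve 4 (λ a b c d → (a :+ b) :+ (c :+ d) := (a :+ c) :+ (b :+ d)) refl (sum n f) (sum n g) (f n) (g n))

  sum-neg : ∀ n (f : ℕ → Carrier) → sum n (λ i → - f i) ≈ - sum n f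
  sum-neg zero    f = solve 0 (con (+ 0) := :- con (+ 0)) refl
  sum-neg (suc n) f = trans (+-cong (sum-neg n f) refl) (solve 2 (λ a b → :- a :+ :- b := :- (a :+ b)) refl (sum n f) (f n))

  *-distribˡ-sum : ∀ n x (f : ℕ → Carrier) → x * sum n f ≈ sum n (λ i → x * f i)
  *-distribˡ-sum zero    x f = solve 1 (λ x → x :* con (+ 0) := con (+ 0)) refl x
  *-distribˡ-sum (suc n) x f = trans (distribˡ x (sum n f) (f n)) (+-cong (*-distribˡ-sum n x f) refl)

  sum-head : ∀ n (f : ℕ → Carrier) → sum (suc n) f ≈ f 0 + sum n (λ i → f (suc i))
  sum-head zero    f = +-comm (ι (+ 0)) (f 0)
  sum-head (suc n) f = trans (+-cong (sum-head n f) refl) (+-assoc (f 0) _ _)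

  sum-shift : ∀ M x (f g : ℕ → Carrier) → f 0 ≈ 0# → g M ≈ 0# → (∀ i → f (suc i) ≈ x * g i) →
              sum (suc M) f ≈ x * sum (suc M) g
  sum-shift M x f g f0≈0 gM≈0 f∘suc≈x*g = begin
    sum (suc M) f                        ≈⟨ sum-head M f ⟩
    f 0 + sum M (λ i → f (suc i))        ≈⟨ +-cong f0≈0 (sum-cong M f∘suc≈x*g) ⟩
    0# + sum M (λ i → x * g i)           ≈⟨ +-identityˡ _ ⟩
    sum M (λ i → x * g i)                ≈⟨ *-distribˡ-sum M x g ⟨
    x * sum M g                          ≈⟨ *-congˡ (+-identityʳ (sum M g)) ⟨
    x * (sum M g + 0#)                   ≈⟨ *-congˡ (+-congˡ gM≈0) ⟨
    x * sum (suc M) g                    ∎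

  sum-truncate : ∀ m {f : ℕ → Carrier} → (∀ i → m ≤ i → f i ≈ 0#) → ∀ n → m ≤ n → sum n f ≈ sum m f
  sum-truncate m f≈0 n m≤n with ℕ.m≤n⇒m<n∨m≡n m≤n
  sum-truncate m f≈0 (suc n) _ | inj₁ (s≤s m≤n) =
    trans (+-cong (sum-truncate m f≈0 n m≤n) (f≈0 n m≤n)) (+-identityʳ _)
  ... | inj₂ ≡.refl = refl

  sum-single : ∀ n i₀ {f : ℕ → Carrier} → i₀ < n → (∀ i → i ≢ i₀ → f i ≈ 0#) → sum n f ≈ f i₀
  sum-single (suc n) i₀ i₀<1+n f≈0 with ℕ.m≤n⇒m<n∨m≡n i₀<1+n
  ... | inj₂ ≡.refl = trans (+-cong (sum-zero n (λ i i<n → f≈0 i (ℕ.<⇒≢ i<n))) refl) (+-identityˡ _)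
  ... | inj₁ (s≤s i₀<n) = trans (+-cong (sum-single n i₀ i₀<n f≈0) (f≈0 n (ℕ.<⇒≢ i₀<n ∘ ≡.sym))) (+-identityʳ _)

  box : ℕ → (ℕ → ℕ → ℕ → Carrier) → Carrier
  box N F = sum N λ k → sum N λ l → sum N λ j → F k l j

  box-cong : ∀ N {F G : ℕ → ℕ → ℕ → Carrier} → (∀ k l j → F k l j ≈ G k l j) → box N F ≈ box N G
  box-cong N F≈G = sum-cong N λ k → sum-cong N λ l → sum-cong N λ j → F≈G k l j

  box-+ : ∀ N (F G : ℕ → ℕ → ℕ → Carrier) → box N (λ k l j → F k l j + G k l j) ≈ box N F + box N G
  box-+ N F G = trans (sum-cong N λ k → trans (sum-cong N λ l → sum-+ N (F k l) (G k l)) (sum-+ N _ _)) (sum-+ N _ _)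

  box-neg : ∀ N (F : ℕ → ℕ → ℕ → Carrier) → box N (λ k l j → - F k l j) ≈ - box N F
  box-neg N F = trans (sum-cong N λ k → trans (sum-cong N λ l → sum-neg N (F k l)) (sum-neg N _)) (sum-neg N _)

  *-distribˡ-sum² : ∀ N x (F : ℕ → ℕ → Carrier) →
                    x * (sum N λ k → sum N λ l → F k l) ≈ (sum N λ k → sum N λ l → x * F k l)
  *-distribˡ-sum² N x F = trans (*-distribˡ-sum N x _) (sum-cong N λ k → *-distribˡ-sum N x (F k))

  evalBox : ℕ → (ℕ → ℕ → ℕ → ℤ) → Carrier → Carrier → Carrier → Carrier
  evalBox N c X Y Z = box N (term c X Y Z)

  term-zero : ∀ c X Y Z k l j → c k l j ≡ + 0 → term c X Y Z k l j ≈ 0#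
  term-zero c X Y Z k l j c≡0 = trans (*-congʳ (trans (reflexive (≡.cong ι c≡0)) 0#-homo)) (zeroˡ _)

  term-cong : ∀ {c c′} X Y Z k l j → c k l j ≡ c′ k l j → term c X Y Z k l j ≈ term c′ X Y Z k l j
  term-cong X Y Z k l j c≡c′ = *-congʳ (reflexive (≡.cong ι c≡c′))

  evalBox-cong : ∀ N {c c′} X Y Z → (∀ k l j → c k l j ≡ c′ k l j) → evalBox N c X Y Z ≈ evalBox N c′ X Y Z
  evalBox-cong N {c} {c′} X Y Z c≡c′ = box-cong N λ k l j → term-cong {c} {c′} X Y Z k l j (c≡c′ k l j)

  evalBox-+ : ∀ N a b X Y Z → evalBox N (λ k l j → a k l j ℤ.+ b k l j) X Y Z ≈ evalBox N a X Y Z + evalBox N b X Y Z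
  evalBox-+ N a b X Y Z = trans (box-cong N λ k l j → trans (*-congʳ (+-homo (a k l j) (b k l j))) (distribʳ _ _ _)) (box-+ N _ _)

  evalBox-neg : ∀ N a X Y Z → evalBox N (λ k l j → ℤ.- a k l j) X Y Z ≈ - evalBox N a X Y Z
  evalBox-neg N a X Y Z = trans (box-cong N λ k l j → trans (*-congʳ (-‿homo (a k l j))) (sym (-‿distribˡ-* _ _))) (box-neg N _)

  evalBox-↓j : ∀ M c X Y Z → (∀ k l → c k l M ≡ + 0) → evalBox (suc M) (↓j c) X Y Z ≈ Y * evalBox (suc M) c X Y Z
  evalBox-↓j M c X Y Z c[M]≡0 = begin
    evalBox (suc M) (↓j c) X Y Z
      ≈⟨ (sum-cong N λ k → sum-cong N λ l → sum-shift M Y _ _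
           (term-zero (↓j c) X Y Z k l 0 ≡.refl) (term-zero c X Y Z k l M (c[M]≡0 k l))
           λ j → move (ι (c k l j)) (pow X k) (pow Z l) Y (pow Y j)) ⟩
    (sum N λ k → sum N λ l → Y * sum N λ j → term c X Y Z k l j)
      ≈⟨ *-distribˡ-sum² N Y _ ⟨
    Y * evalBox (suc M) c X Y Z ∎
    where
    N = suc M
    move : ∀ a x z y u → a * (x * (z * (y * u))) ≈ y * (a * (x * (z * u)))
    move = solve 5 (λ a x z y u → a :* (x :* (z :* (y :* u))) := y :* (a :* (x :* (z :* u)))) refl

  evalBox-↓k : ∀ M c X Y Z → (∀ l j → c M l j ≡ + 0) → evalBox (suc M) (↓k c) X Y Z ≈ X * evalBox (suc M) c X Y Z
  evalBox-↓k M c X Y Z c[M]≡0 = sum-shift M X _ _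
    (sum-zero N λ l _ → sum-zero N λ j _ → term-zero (↓k c) X Y Z 0 l j ≡.refl)
    (sum-zero N λ l _ → sum-zero N λ j _ → term-zero c X Y Z M l j (c[M]≡0 l j))
    λ k → trans (sum-cong N λ l → sum-cong N λ j → move (ι (c k l j)) X (pow X k) (pow Z l * pow Y j))
                (sym (*-distribˡ-sum² N X _))
    where
    N = suc M
    move : ∀ a x p q → a * ((x * p) * q) ≈ x * (a * (p * q))
    move = solve 4 (λ a x p q → a :* ((x :* p) :* q) := x :* (a :* (p :* q))) refl

  evalBox-↓l : ∀ M c X Y Z → (∀ k j → c k M j ≡ + 0) → evalBox (suc M) (↓l c) X Y Z ≈ Z * evalBox (suc M) c X Y Z
  evalBox-↓l M c X Y Z c[M]≡0 = begin
    evalBox (suc M) (↓l c) X Y Z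
      ≈⟨ (sum-cong N λ k → sum-shift M Z _ _
           (sum-zero N λ j _ → term-zero (↓l c) X Y Z k 0 j ≡.refl)
           (sum-zero N λ j _ → term-zero c X Y Z k M j (c[M]≡0 k j))
           λ l → trans (sum-cong N λ j → move (ι (c k l j)) (pow X k) Z (pow Z l) (pow Y j))
                       (sym (*-distribˡ-sum N Z _))) ⟩
    (sum N λ k → Z * sum N λ l → sum N λ j → term c X Y Z k l j)
      ≈⟨ *-distribˡ-sum N Z _ ⟨
    Z * evalBox (suc M) c X Y Z ∎
    where
    N = suc M
    move : ∀ a x z w y → a * (x * ((z * w) * y)) ≈ z * (a * (x * (w * y)))
    move = solve 5 (λ a x z w y → a :* (x :* ((z :* w) :* y)) := z :* (a :* (x :* (w :* y)))) refl

  waringTerm-outside : ∀ d X Y Z k l → d < weight k l → waringTerm d X Y Z k l ≈ 0#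
  waringTerm-outside d X Y Z k l d<w with weight k l ≤ᵇ d in w≤ᵇd
  ... | true  = contradiction (ℕ.≤ᵇ⇒≤ _ d (subst T (≡.sym w≤ᵇd) _)) (ℕ.<⇒≱ d<w)
  ... | false = 0#-homo

  sum-component : ∀ d M X Y Z k l → d ≤ M →
    sum (suc M) (λ j → term (component d waringCoefficient) X Y Z k l j) ≈ waringTerm d X Y Z k l
  sum-component d M X Y Z k l d≤M with weight k l ≤ᵇ d in w≤ᵇd
  ... | false = trans (sum-zero (suc M) λ j _ → term-zero (component d waringCoefficient) X Y Z k l j
                        (component-off d waringCoefficient k l j (deg≢d j)))
                      (sym 0#-homo)
    where
    deg≢d : ∀ j → degree k l j ≢ d
    deg≢d j deg≡d = subst T w≤ᵇd (ℕ.≤⇒≤ᵇ (subst (weight k l ≤_) deg≡d (ℕ.m≤m+n (weight k l) j)))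
  ... | true  = trans (sum-single (suc M) j₀ (s≤s (ℕ.≤-trans j₀≤d d≤M)) off-j₀) on-j₀
    where
    j₀ = d ∸ 2 ℕ.* k ∸ 3 ℕ.* l
    j₀≤d : j₀ ≤ d
    j₀≤d = ℕ.≤-trans (ℕ.m∸n≤m (d ∸ 2 ℕ.* k) (3 ℕ.* l)) (ℕ.m∸n≤m d (2 ℕ.* k))
    off-j₀ : ∀ j → j ≢ j₀ → term (component d waringCoefficient) X Y Z k l j ≈ 0#
    off-j₀ j j≢j₀ = term-zero (component d waringCoefficient) X Y Z k l j (component-off d waringCoefficient k l j λ deg≡d →
      j≢j₀ (≡.trans (≡.sym (degree∸weight k l j)) (≡.cong (λ n → n ∸ 2 ℕ.* k ∸ 3 ℕ.* l) deg≡d)))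
    on-j₀ : term (component d waringCoefficient) X Y Z k l j₀ ≈ term waringCoefficient X Y Z k l j₀
    on-j₀ = term-cong {component d waringCoefficient} {waringCoefficient} X Y Z k l j₀
      (component-on d waringCoefficient k l j₀ (degree-complement d k l (ℕ.≤ᵇ⇒≤ _ d (subst T (≡.sym w≤ᵇd) _))))

  evalBox-component : ∀ d M X Y Z → d ≤ M → evalBox (suc M) (component d waringCoefficient) X Y Z ≈ waringForm d X Y Z
  evalBox-component d M X Y Z d≤M = begin
    evalBox (suc M) (component d waringCoefficient) X Y Z
      ≈⟨ (sum-cong (suc M) λ k → sum-cong (suc M) λ l → sum-component d M X Y Z k l d≤M) ⟩
    (sum (suc M) λ k → sum (suc M) λ l → waringTerm d X Y Z k l)
      ≈⟨ (sum-cong (suc M) λ k → sum-truncate (suc d) (λ l d<l → outside k l (ℕ.≤-trans d<l (l≤weight k l))) (suc M) 1+d≤1+M) ⟩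
    (sum (suc M) λ k → sum (suc d) λ l → waringTerm d X Y Z k l)
      ≈⟨ sum-truncate (suc d) (λ k d<k → sum-zero (suc d) λ l _ → outside k l (ℕ.≤-trans d<k (k≤weight k l))) (suc M) 1+d≤1+M ⟩
    waringForm d X Y Z ∎
    where
    outside = waringTerm-outside d X Y Z
    1+d≤1+M = s≤s d≤M

  evalBox-recurrence : ∀ e X Y Z →
    evalBox (5 ℕ.+ e) (component (4 ℕ.+ e) waringCoefficient) X Y Z
      ≈ Y * evalBox (5 ℕ.+ e) (component (3 ℕ.+ e) waringCoefficient) X Y Z
        - X * evalBox (5 ℕ.+ e) (component (2 ℕ.+ e) waringCoefficient) X Y Z
        + Z * evalBox (5 ℕ.+ e) (component (1 ℕ.+ e) waringCoefficient) X Y Z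
  evalBox-recurrence e X Y Z = begin
    evalBox N (component (4 ℕ.+ e) waringCoefficient) X Y Z
      ≈⟨ evalBox-cong N X Y Z (component-recurrence e) ⟩
    evalBox N (λ k l j → ↓j c₃ k l j ℤ.- ↓k c₂ k l j ℤ.+ ↓l c₁ k l j) X Y Z
      ≈⟨ evalBox-+ N _ (↓l c₁) X Y Z ⟩
    evalBox N (λ k l j → ↓j c₃ k l j ℤ.- ↓k c₂ k l j) X Y Z + evalBox N (↓l c₁) X Y Z
      ≈⟨ +-congʳ (trans (evalBox-+ N (↓j c₃) _ X Y Z) (+-congˡ (evalBox-neg N (↓k c₂) X Y Z))) ⟩
    evalBox N (↓j c₃) X Y Z - evalBox N (↓k c₂) X Y Z + evalBox N (↓l c₁) X Y Z
      ≈⟨ +-cong (+-cong (evalBox-↓j M c₃ X Y Z vanishʲ) (-‿cong (evalBox-↓k M c₂ X Y Z vanishᵏ)))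
                (evalBox-↓l M c₁ X Y Z vanishˡ) ⟩
    Y * evalBox N c₃ X Y Z - X * evalBox N c₂ X Y Z + Z * evalBox N c₁ X Y Z ∎
    where
    M = 4 ℕ.+ e
    N = suc M
    c₃ = component (3 ℕ.+ e) waringCoefficient
    c₂ = component (2 ℕ.+ e) waringCoefficient
    c₁ = component (1 ℕ.+ e) waringCoefficient
    vanishʲ : ∀ k l → c₃ k l M ≡ + 0
    vanishʲ k l = component-off (3 ℕ.+ e) waringCoefficient k l M
      (ℕ.<⇒≢ (j≤degree k l M) ∘ ≡.sym)
    vanishᵏ : ∀ l j → c₂ M l j ≡ + 0
    vanishᵏ l j = component-off (2 ℕ.+ e) waringCoefficient M l j
      (ℕ.<⇒≢ (ℕ.≤-trans (ℕ.n≤1+n (3 ℕ.+ e)) (ℕ.≤-trans (k≤weight M l) (ℕ.m≤m+n _ j))) ∘ ≡.sym)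
    vanishˡ : ∀ k j → c₁ k M j ≡ + 0
    vanishˡ k j = component-off (1 ℕ.+ e) waringCoefficient k M j
      (ℕ.<⇒≢ (ℕ.≤-trans (ℕ.m≤n+m (2 ℕ.+ e) 2) (ℕ.≤-trans (l≤weight k M) (ℕ.m≤m+n _ j))) ∘ ≡.sym)

  waringForm-recurrence : ∀ e X Y Z →
    waringForm (4 ℕ.+ e) X Y Z ≈ Y * waringForm (3 ℕ.+ e) X Y Z - X * waringForm (2 ℕ.+ e) X Y Z + Z * waringForm (1 ℕ.+ e) X Y Z
  waringForm-recurrence e X Y Z = begin
    waringForm (4 ℕ.+ e) X Y Z
      ≈⟨ evalBox-component (4 ℕ.+ e) M X Y Z ℕ.≤-refl ⟨
    evalBox (suc M) (component (4 ℕ.+ e) waringCoefficient) X Y Z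
      ≈⟨ evalBox-recurrence e X Y Z ⟩
    Y * evalBox (suc M) (component (3 ℕ.+ e) waringCoefficient) X Y Z
      - X * evalBox (suc M) (component (2 ℕ.+ e) waringCoefficient) X Y Z
      + Z * evalBox (suc M) (component (1 ℕ.+ e) waringCoefficient) X Y Z
      ≈⟨ +-cong (+-cong (*-congˡ (evalBox-component (3 ℕ.+ e) M X Y Z (ℕ.n≤1+n (3 ℕ.+ e))))
                        (-‿cong (*-congˡ (evalBox-component (2 ℕ.+ e) M X Y Z (ℕ.m≤n+m (2 ℕ.+ e) 2)))))
                (*-congˡ (evalBox-component (1 ℕ.+ e) M X Y Z (ℕ.m≤n+m (1 ℕ.+ e) 3))) ⟩
    Y * waringForm (3 ℕ.+ e) X Y Z - X * waringForm (2 ℕ.+ e) X Y Z + Z * waringForm (1 ℕ.+ e) X Y Z ∎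
    where
    M = 4 ℕ.+ e

  pow-cong : ∀ n {x y} → x ≈ y → pow x n ≈ pow y n
  pow-cong zero    x≈y = refl
  pow-cong (suc n) x≈y = *-cong x≈y (pow-cong n x≈y)

  waringForm-cong : ∀ d {X X′ Y Y′ Z Z′} → X ≈ X′ → Y ≈ Y′ → Z ≈ Z′ → waringForm d X Y Z ≈ waringForm d X′ Y′ Z′
  waringForm-cong d {X} {X′} {Y} {Y′} {Z} {Z′} X≈X′ Y≈Y′ Z≈Z′ =
    sum-cong (suc d) λ k → sum-cong (suc d) λ l → termwise k l
    where
    termwise : ∀ k l → waringTerm d X Y Z k l ≈ waringTerm d X′ Y′ Z′ k l
    termwise k l with weight k l ≤ᵇ d
    ... | true  = *-congˡ (*-cong (pow-cong k X≈X′) (*-cong (pow-cong l Z≈Z′) (pow-cong (d ∸ 2 ℕ.* k ∸ 3 ℕ.* l) Y≈Y′)))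
    ... | false = refl

  newton : ∀ n x y z → powerSum (3 ℕ.+ n) x y z
    ≈ e₁ x y z * powerSum (2 ℕ.+ n) x y z - e₂ x y z * powerSum (1 ℕ.+ n) x y z + e₃ x y z * powerSum n x y z
  newton n x y z = solve 6 (λ x y z u v w →
      x :* (x :* (x :* u)) :+ y :* (y :* (y :* v)) :+ z :* (z :* (z :* w))
    := (x :+ y :+ z) :* (x :* (x :* u) :+ y :* (y :* v) :+ z :* (z :* w))
       :- (x :* y :+ x :* z :+ y :* z) :* (x :* u :+ y :* v :+ z :* w)
       :+ x :* y :* z :* (u :+ v :+ w))
    refl x y z (pow x n) (pow y n) (pow z n)

  -- At the solver's syntax, waringForm d computes an expression denoting waringForm d in R,
  -- so for fixed small d the identity is decided by normalisation.
  private
    module Syntax = WaringForm {A = Polynomial 3} _:+_ _:*_ con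

    girard-waring-syntax : ℕ → Polynomial 3 → Polynomial 3 → Polynomial 3 → Polynomial 3 × Polynomial 3
    girard-waring-syntax d x y z =
      Syntax.waringForm d (Syntax.e₂ x y z) (Syntax.e₁ x y z) (Syntax.e₃ x y z) := :- Syntax.powerSum d x y z

  girard-waring : ∀ d x y z → waringForm (suc d) (e₂ x y z) (e₁ x y z) (e₃ x y z) ≈ - powerSum (suc d) x y z
  girard-waring 0 = solve 3 (girard-waring-syntax 1) refl
  girard-waring 1 = solve 3 (girard-waring-syntax 2) refl
  girard-waring 2 = solve 3 (girard-waring-syntax 3) refl
  girard-waring (suc (suc (suc e))) x y z = begin
    waringForm (4 ℕ.+ e) X Y Z
      ≈⟨ waringForm-recurrence e X Y Z ⟩
    Y * waringForm (3 ℕ.+ e) X Y Z - X * waringForm (2 ℕ.+ e) X Y Z + Z * waringForm (1 ℕ.+ e) X Y Z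
      ≈⟨ +-cong (+-cong (*-congˡ (girard-waring (suc (suc e)) x y z)) (-‿cong (*-congˡ (girard-waring (suc e) x y z))))
                (*-congˡ (girard-waring e x y z)) ⟩
    Y * - p₃ - X * - p₂ + Z * - p₁
      ≈⟨ solve 6 (λ X Y Z p₃ p₂ p₁ → Y :* :- p₃ :- X :* :- p₂ :+ Z :* :- p₁ := :- (Y :* p₃ :- X :* p₂ :+ Z :* p₁))
               refl X Y Z p₃ p₂ p₁ ⟩
    - (Y * p₃ - X * p₂ + Z * p₁)
      ≈⟨ -‿cong (newton (suc e) x y z) ⟨
    - powerSum (4 ℕ.+ e) x y z ∎
    where
    X = e₂ x y z
    Y = e₁ x y z
    Z = e₃ x y z
    p₃ = powerSum (3 ℕ.+ e) x y z
    p₂ = powerSum (2 ℕ.+ e) x y z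
    p₁ = powerSum (1 ℕ.+ e) x y z

module Laurent where

  open import Data.Bool using (true; false; if_then_else_)
  open import Data.Integer as ℤ using (ℤ; +_)
  import Data.Integer.Properties as ℤ
  import Data.Integer.Tactic.RingSolver as ℤ-Solver
  open import Data.Rational as ℚ using (ℚ; 0ℚ; 1ℚ)
  import Data.Rational.Properties as ℚ
  import Data.Rational.Unnormalised as ℚᵘ
  import Data.Rational.Unnormalised.Properties as ℚᵘ
  open import Data.Rational.Solver using (module +-*-Solver)
  open import Data.List using ([]; _∷_; _++_)
  import Data.List.Properties as List
  open import Data.Product using (_×_; _,_)
  open import Data.Empty using (⊥-elim)
  open import Level using (0ℓ)
  open import Relation.Nullary using (yes; no; does)
  open import Relation.Binary.PropositionalEquality

  open import Defs
  open +-*-Solver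

  coeff-++ : ∀ p q n → coeff (p ++ q) n ≡ coeff p n ℚ.+ coeff q n
  coeff-++ []            q n = sym (ℚ.+-identityˡ _)
  coeff-++ ((c , e) ∷ p) q n with does (e ℤ.≟ n)
  ... | true  = trans (cong (c ℚ.+_) (coeff-++ p q n)) (sym (ℚ.+-assoc c _ _))
  ... | false = coeff-++ p q n

  coeff-scaleL : ∀ a p n → coeff (scaleL a p) n ≡ a ℚ.* coeff p n
  coeff-scaleL a []            n = sym (ℚ.*-zeroʳ a)
  coeff-scaleL a ((c , e) ∷ p) n with does (e ℤ.≟ n)
  ... | true  = trans (cong (a ℚ.* c ℚ.+_) (coeff-scaleL a p n)) (sym (ℚ.*-distribˡ-+ a c _))
  ... | false = coeff-scaleL a p n

  convolve : LP → (ℤ → ℚ) → ℤ → ℚ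
  convolve []            f n = 0ℚ
  convolve ((a , m) ∷ p) f n = a ℚ.* f (n ℤ.- m) ℚ.+ convolve p f n

  private
    m+k≡n⇒k≡n-m : ∀ m k n → m ℤ.+ k ≡ n → k ≡ n ℤ.- m
    m+k≡n⇒k≡n-m m k n refl = ℤ-Solver.solve (m ∷ k ∷ [])

    k≡n-m⇒m+k≡n : ∀ m k n → k ≡ n ℤ.- m → m ℤ.+ k ≡ n
    k≡n-m⇒m+k≡n m k n refl = ℤ-Solver.solve (m ∷ n ∷ [])

    sub-+ : ∀ n m k → n ℤ.- (m ℤ.+ k) ≡ n ℤ.- m ℤ.- k
    sub-+ = ℤ-Solver.solve-∀

  coeff-monomial-*L : ∀ a m q n → coeff (((a , m) ∷ []) *L q) n ≡ a ℚ.* coeff q (n ℤ.- m)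
  coeff-monomial-*L a m []            n = sym (ℚ.*-zeroʳ a)
  coeff-monomial-*L a m ((b , k) ∷ q) n with (m ℤ.+ k) ℤ.≟ n | k ℤ.≟ (n ℤ.- m)
  ... | yes _ | yes _ = trans (cong (a ℚ.* b ℚ.+_) (coeff-monomial-*L a m q n)) (sym (ℚ.*-distribˡ-+ a b _))
  ... | no  _ | no  _ = coeff-monomial-*L a m q n
  ... | yes m+k≡n | no k≢n-m = ⊥-elim (k≢n-m (m+k≡n⇒k≡n-m m k n m+k≡n))
  ... | no m+k≢n | yes k≡n-m = ⊥-elim (m+k≢n (k≡n-m⇒m+k≡n m k n k≡n-m))

  *L-cons : ∀ x p q → (x ∷ p) *L q ≡ ((x ∷ []) *L q) ++ (p *L q)
  *L-cons x p q = cong (_++ (p *L q)) (sym (List.++-identityʳ _))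

  coeff-*L : ∀ p q n → coeff (p *L q) n ≡ convolve p (coeff q) n
  coeff-*L []            q n = refl
  coeff-*L ((a , m) ∷ p) q n = begin
    coeff (((a , m) ∷ p) *L q) n
      ≡⟨ cong (λ r → coeff r n) (*L-cons (a , m) p q) ⟩
    coeff ((((a , m) ∷ []) *L q) ++ (p *L q)) n
      ≡⟨ coeff-++ (((a , m) ∷ []) *L q) (p *L q) n ⟩
    coeff (((a , m) ∷ []) *L q) n ℚ.+ coeff (p *L q) n
      ≡⟨ cong₂ ℚ._+_ (coeff-monomial-*L a m q n) (coeff-*L p q n) ⟩
    convolve ((a , m) ∷ p) (coeff q) n ∎
    where open ≡-Reasoning

  convolve-cong : ∀ p {f g : ℤ → ℚ} n → (∀ x → f x ≡ g x) → convolve p f n ≡ convolve p g n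
  convolve-cong []            n f≡g = refl
  convolve-cong ((a , m) ∷ p) n f≡g = cong₂ ℚ._+_ (cong (a ℚ.*_) (f≡g _)) (convolve-cong p n f≡g)

  convolve-+ : ∀ p (f g : ℤ → ℚ) n → convolve p (λ x → f x ℚ.+ g x) n ≡ convolve p f n ℚ.+ convolve p g n
  convolve-+ []            f g n = sym (ℚ.+-identityˡ 0ℚ)
  convolve-+ ((a , m) ∷ p) f g n =
    trans (cong (a ℚ.* (f (n ℤ.- m) ℚ.+ g (n ℤ.- m)) ℚ.+_) (convolve-+ p f g n))
          (solve 5 (λ a x y u v → a :* (x :+ y) :+ (u :+ v) := (a :* x :+ u) :+ (a :* y :+ v)) refl
                 a (f (n ℤ.- m)) (g (n ℤ.- m)) (convolve p f n) (convolve p g n))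

  convolve-++ : ∀ p q f n → convolve (p ++ q) f n ≡ convolve p f n ℚ.+ convolve q f n
  convolve-++ []            q f n = sym (ℚ.+-identityˡ _)
  convolve-++ ((a , m) ∷ p) q f n =
    trans (cong (a ℚ.* f (n ℤ.- m) ℚ.+_) (convolve-++ p q f n)) (sym (ℚ.+-assoc (a ℚ.* f (n ℤ.- m)) _ _))

  convolve-monomial-*L : ∀ a m q f n → convolve (((a , m) ∷ []) *L q) f n ≡ a ℚ.* convolve q f (n ℤ.- m)
  convolve-monomial-*L a m []            f n = sym (ℚ.*-zeroʳ a)
  convolve-monomial-*L a m ((b , k) ∷ q) f n = trans
    (cong₂ (λ u v → a ℚ.* b ℚ.* f u ℚ.+ v) (sub-+ n m k) (convolve-monomial-*L a m q f n))
    (solve 4 (λ a b x y → a :* b :* x :+ a :* y := a :* (b :* x :+ y)) refl a b (f ((n ℤ.- m) ℤ.- k)) (convolve q f (n ℤ.- m)))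

  convolve-*L : ∀ p q f n → convolve (p *L q) f n ≡ convolve p (convolve q f) n
  convolve-*L []            q f n = refl
  convolve-*L ((a , m) ∷ p) q f n = begin
    convolve (((a , m) ∷ p) *L q) f n
      ≡⟨ cong (λ r → convolve r f n) (*L-cons (a , m) p q) ⟩
    convolve ((((a , m) ∷ []) *L q) ++ (p *L q)) f n
      ≡⟨ convolve-++ (((a , m) ∷ []) *L q) (p *L q) f n ⟩
    convolve (((a , m) ∷ []) *L q) f n ℚ.+ convolve (p *L q) f n
      ≡⟨ cong₂ ℚ._+_ (convolve-monomial-*L a m q f n) (convolve-*L p q f n) ⟩
    convolve ((a , m) ∷ p) (convolve q f) n ∎
    where open ≡-Reasoning

  private
    Σ : LP → (ℚ × ℤ → ℚ) → ℚ
    Σ []       f = 0ℚ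
    Σ (x ∷ xs) f = f x ℚ.+ Σ xs f

    Σ-cong : ∀ xs {f g : ℚ × ℤ → ℚ} → (∀ x → f x ≡ g x) → Σ xs f ≡ Σ xs g
    Σ-cong []       f≡g = refl
    Σ-cong (x ∷ xs) f≡g = cong₂ ℚ._+_ (f≡g x) (Σ-cong xs f≡g)

    Σ-+ : ∀ xs f g → Σ xs (λ x → f x ℚ.+ g x) ≡ Σ xs f ℚ.+ Σ xs g
    Σ-+ []       f g = sym (ℚ.+-identityˡ 0ℚ)
    Σ-+ (y ∷ xs) f g = trans (cong (f y ℚ.+ g y ℚ.+_) (Σ-+ xs f g))
      (solve 4 (λ a b c d → a :+ b :+ (c :+ d) := (a :+ c) :+ (b :+ d)) refl (f y) (g y) (Σ xs f) (Σ xs g))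

    Σ-zero : ∀ xs → Σ xs (λ _ → 0ℚ) ≡ 0ℚ
    Σ-zero []       = refl
    Σ-zero (x ∷ xs) = trans (ℚ.+-identityˡ _) (Σ-zero xs)

    Σ-comm : ∀ xs ys (h : ℚ × ℤ → ℚ × ℤ → ℚ) → Σ xs (λ x → Σ ys (h x)) ≡ Σ ys (λ y → Σ xs (λ x → h x y))
    Σ-comm []       ys h = sym (Σ-zero ys)
    Σ-comm (x ∷ xs) ys h = trans (cong (Σ ys (h x) ℚ.+_) (Σ-comm xs ys h)) (sym (Σ-+ ys (h x) _))

    contribution : ℤ → ℚ × ℤ → ℚ × ℤ → ℚ
    contribution n (a , m) (b , k) = if does ((m ℤ.+ k) ℤ.≟ n) then a ℚ.* b else 0ℚ

    contribution-sym : ∀ n x y → contribution n x y ≡ contribution n y x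
    contribution-sym n (a , m) (b , k) rewrite ℤ.+-comm m k | ℚ.*-comm a b = refl

    coeff-monomial-*L-as-Σ : ∀ x q n → coeff ((x ∷ []) *L q) n ≡ Σ q (contribution n x)
    coeff-monomial-*L-as-Σ (a , m) []            n = refl
    coeff-monomial-*L-as-Σ (a , m) ((b , k) ∷ q) n with does ((m ℤ.+ k) ℤ.≟ n)
    ... | true  = cong (a ℚ.* b ℚ.+_) (coeff-monomial-*L-as-Σ (a , m) q n)
    ... | false = trans (coeff-monomial-*L-as-Σ (a , m) q n) (sym (ℚ.+-identityˡ _))

    coeff-*L-as-Σ : ∀ p q n → coeff (p *L q) n ≡ Σ p λ x → Σ q (contribution n x)
    coeff-*L-as-Σ []      q n = refl
    coeff-*L-as-Σ (x ∷ p) q n = begin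
      coeff ((x ∷ p) *L q) n                              ≡⟨ cong (λ r → coeff r n) (*L-cons x p q) ⟩
      coeff (((x ∷ []) *L q) ++ (p *L q)) n               ≡⟨ coeff-++ ((x ∷ []) *L q) (p *L q) n ⟩
      coeff ((x ∷ []) *L q) n ℚ.+ coeff (p *L q) n        ≡⟨ cong₂ ℚ._+_ (coeff-monomial-*L-as-Σ x q n) (coeff-*L-as-Σ p q n) ⟩
      Σ (x ∷ p) (λ x → Σ q (contribution n x))            ∎
      where open ≡-Reasoning

  *L-comm : ∀ p q → p *L q ≈L q *L p
  *L-comm p q n = begin
    coeff (p *L q) n                                   ≡⟨ coeff-*L-as-Σ p q n ⟩
    Σ p (λ x → Σ q (contribution n x))                 ≡⟨ Σ-comm p q (contribution n) ⟩
    Σ q (λ y → Σ p (λ x → contribution n x y))         ≡⟨ Σ-cong q (λ y → Σ-cong p (λ x → contribution-sym n x y)) ⟩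
    Σ q (λ y → Σ p (contribution n y))                 ≡⟨ coeff-*L-as-Σ q p n ⟨
    coeff (q *L p) n                                   ∎
    where open ≡-Reasoning

  +L-cong : ∀ {p p′ q q′} → p ≈L p′ → q ≈L q′ → p +L q ≈L p′ +L q′
  +L-cong {p} {p′} {q} {q′} p≈p′ q≈q′ n =
    trans (coeff-++ p q n) (trans (cong₂ ℚ._+_ (p≈p′ n) (q≈q′ n)) (sym (coeff-++ p′ q′ n)))

  +L-comm : ∀ p q → p +L q ≈L q +L p
  +L-comm p q n = trans (coeff-++ p q n) (trans (ℚ.+-comm (coeff p n) (coeff q n)) (sym (coeff-++ q p n)))

  negL-cong : ∀ {p q} → p ≈L q → negL p ≈L negL q
  negL-cong {p} {q} p≈q n =
    trans (coeff-scaleL (ℚ.- 1ℚ) p n) (trans (cong (ℚ.- 1ℚ ℚ.*_) (p≈q n)) (sym (coeff-scaleL (ℚ.- 1ℚ) q n)))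

  negL-inverseˡ : ∀ p → negL p +L p ≈L []
  negL-inverseˡ p n = trans (coeff-++ (negL p) p n)
    (trans (cong (ℚ._+ coeff p n) (coeff-scaleL (ℚ.- 1ℚ) p n))
           (solve 1 (λ x → con (ℚ.- 1ℚ) :* x :+ x := con 0ℚ) refl (coeff p n)))

  *L-congˡ : ∀ p {q q′} → q ≈L q′ → p *L q ≈L p *L q′
  *L-congˡ p {q} {q′} q≈q′ n = trans (coeff-*L p q n) (trans (convolve-cong p n q≈q′) (sym (coeff-*L p q′ n)))

  *L-cong : ∀ {p p′ q q′} → p ≈L p′ → q ≈L q′ → p *L q ≈L p′ *L q′
  *L-cong {p} {p′} {q} {q′} p≈p′ q≈q′ n =
    trans (*L-congˡ p q≈q′ n) (trans (*L-comm p q′ n) (trans (*L-congˡ q′ p≈p′ n) (*L-comm q′ p′ n)))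

  *L-assoc : ∀ p q r → (p *L q) *L r ≈L p *L (q *L r)
  *L-assoc p q r n = begin
    coeff ((p *L q) *L r) n                    ≡⟨ coeff-*L (p *L q) r n ⟩
    convolve (p *L q) (coeff r) n              ≡⟨ convolve-*L p q (coeff r) n ⟩
    convolve p (convolve q (coeff r)) n        ≡⟨ convolve-cong p n (λ x → coeff-*L q r x) ⟨
    convolve p (coeff (q *L r)) n              ≡⟨ coeff-*L p (q *L r) n ⟨
    coeff (p *L (q *L r)) n                    ∎
    where open ≡-Reasoning

  *L-identityˡ : ∀ p → oneL *L p ≈L p
  *L-identityˡ p n = trans (coeff-*L oneL p n)
    (trans (ℚ.+-identityʳ _) (trans (ℚ.*-identityˡ _) (cong (coeff p) (ℤ.+-identityʳ n))))

  *L-distribˡ : ∀ p q r → p *L (q +L r) ≈L p *L q +L p *L r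
  *L-distribˡ p q r n = begin
    coeff (p *L (q ++ r)) n                                 ≡⟨ coeff-*L p (q ++ r) n ⟩
    convolve p (coeff (q ++ r)) n                           ≡⟨ convolve-cong p n (coeff-++ q r) ⟩
    convolve p (λ x → coeff q x ℚ.+ coeff r x) n            ≡⟨ convolve-+ p (coeff q) (coeff r) n ⟩
    convolve p (coeff q) n ℚ.+ convolve p (coeff r) n       ≡⟨ cong₂ ℚ._+_ (coeff-*L p q n) (coeff-*L p r n) ⟨
    coeff (p *L q) n ℚ.+ coeff (p *L r) n                   ≡⟨ coeff-++ (p *L q) (p *L r) n ⟨
    coeff (p *L q ++ p *L r) n                              ∎
    where open ≡-Reasoning

  *L-distribʳ : ∀ p q r → (q +L r) *L p ≈L q *L p +L r *L p
  *L-distribʳ p q r n = begin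
    coeff ((q ++ r) *L p) n                                 ≡⟨ coeff-*L (q ++ r) p n ⟩
    convolve (q ++ r) (coeff p) n                           ≡⟨ convolve-++ q r (coeff p) n ⟩
    convolve q (coeff p) n ℚ.+ convolve r (coeff p) n       ≡⟨ cong₂ ℚ._+_ (coeff-*L q p n) (coeff-*L r p n) ⟨
    coeff (q *L p) n ℚ.+ coeff (r *L p) n                   ≡⟨ coeff-++ (q *L p) (r *L p) n ⟨
    coeff (q *L p ++ r *L p) n                              ∎
    where open ≡-Reasoning

  laurentRing : CommutativeRing 0ℓ 0ℓ
  laurentRing = record
    { Carrier = LP
    ; _≈_ = _≈L_
    ; _+_ = _+L_
    ; _*_ = _*L_
    ; -_ = negL
    ; 0# = []
    ; 1# = oneL
    ; isCommutativeRing = record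
      { isRing = record
        { +-isAbelianGroup = record
          { isGroup = record
            { isMonoid = record
              { isSemigroup = record
                { isMagma = record
                  { isEquivalence = record
                    { refl = λ n → refl ; sym = λ p≈q n → sym (p≈q n) ; trans = λ p≈q q≈r n → trans (p≈q n) (q≈r n) }
                  ; ∙-cong = λ {p} {p′} {q} {q′} → +L-cong {p} {p′} {q} {q′} }
                ; assoc = λ p q r n → cong (λ s → coeff s n) (List.++-assoc p q r) }
              ; identity = (λ p n → refl) , (λ p n → cong (λ s → coeff s n) (List.++-identityʳ p)) }
            ; inverse = negL-inverseˡ , λ p n → trans (+L-comm p (negL p) n) (negL-inverseˡ p n)
            ; ⁻¹-cong = λ {p} {q} → negL-cong {p} {q} }
          ; comm = +L-comm }
        ; *-cong = λ {p} {p′} {q} {q′} → *L-cong {p} {p′} {q} {q′}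
        ; *-assoc = *L-assoc
        ; *-identity = *L-identityˡ , λ p n → trans (*L-comm p oneL n) (*L-identityˡ p n)
        ; distrib = *L-distribˡ , *L-distribʳ }
      ; *-comm = *L-comm } }

  trinomial : ℚ × ℤ → ℚ × ℤ → ℚ × ℤ → LP
  trinomial u v w = u ∷ v ∷ w ∷ []

  trinomial-≡ : ∀ {u u′ v v′ w w′} → u ≡ u′ → v ≡ v′ → w ≡ w′ → trinomial u v w ≡ trinomial u′ v′ w′
  trinomial-≡ refl refl refl = refl

  trinomial-reverse : ∀ u v w → trinomial u v w ≈L trinomial w v u
  trinomial-reverse u v w n = begin
    coeff (trinomial u v w) n            ≡⟨ coeff-++ (u ∷ []) (v ∷ w ∷ []) n ⟩
    cu ℚ.+ coeff (v ∷ w ∷ []) n          ≡⟨ cong (cu ℚ.+_) (coeff-++ (v ∷ []) (w ∷ []) n) ⟩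
    cu ℚ.+ (cv ℚ.+ cw)                   ≡⟨ solve 3 (λ x y z → x :+ (y :+ z) := z :+ (y :+ x)) refl cu cv cw ⟩
    cw ℚ.+ (cv ℚ.+ cu)                   ≡⟨ cong (cw ℚ.+_) (coeff-++ (v ∷ []) (u ∷ []) n) ⟨
    cw ℚ.+ coeff (v ∷ u ∷ []) n          ≡⟨ coeff-++ (w ∷ []) (v ∷ u ∷ []) n ⟨
    coeff (trinomial w v u) n            ∎
    where
    open ≡-Reasoning
    cu = coeff (u ∷ []) n
    cv = coeff (v ∷ []) n
    cw = coeff (w ∷ []) n

  integer : ℤ → LP
  integer z = (z ℚ./ 1 , + 0) ∷ []

  private
    fromℚᵘ-homo-+ : ∀ p q → ℚ.fromℚᵘ (p ℚᵘ.+ q) ≡ ℚ.fromℚᵘ p ℚ.+ ℚ.fromℚᵘ q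
    fromℚᵘ-homo-+ p q = ℚ.toℚᵘ-injective (begin
      ℚ.toℚᵘ (ℚ.fromℚᵘ (p ℚᵘ.+ q))                       ≈⟨ ℚ.toℚᵘ-fromℚᵘ (p ℚᵘ.+ q) ⟩
      p ℚᵘ.+ q                                            ≈⟨ ℚᵘ.+-cong (ℚ.toℚᵘ-fromℚᵘ p) (ℚ.toℚᵘ-fromℚᵘ q) ⟨
      ℚ.toℚᵘ (ℚ.fromℚᵘ p) ℚᵘ.+ ℚ.toℚᵘ (ℚ.fromℚᵘ q)       ≈⟨ ℚ.toℚᵘ-homo-+ (ℚ.fromℚᵘ p) (ℚ.fromℚᵘ q) ⟨
      ℚ.toℚᵘ (ℚ.fromℚᵘ p ℚ.+ ℚ.fromℚᵘ q)                 ∎)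
      where open import Relation.Binary.Reasoning.Setoid ℚᵘ.≃-setoid

    fromℚᵘ-homo-* : ∀ p q → ℚ.fromℚᵘ (p ℚᵘ.* q) ≡ ℚ.fromℚᵘ p ℚ.* ℚ.fromℚᵘ q
    fromℚᵘ-homo-* p q = ℚ.toℚᵘ-injective (begin
      ℚ.toℚᵘ (ℚ.fromℚᵘ (p ℚᵘ.* q))                       ≈⟨ ℚ.toℚᵘ-fromℚᵘ (p ℚᵘ.* q) ⟩
      p ℚᵘ.* q                                            ≈⟨ ℚᵘ.*-cong (ℚ.toℚᵘ-fromℚᵘ p) (ℚ.toℚᵘ-fromℚᵘ q) ⟨
      ℚ.toℚᵘ (ℚ.fromℚᵘ p) ℚᵘ.* ℚ.toℚᵘ (ℚ.fromℚᵘ q)       ≈⟨ ℚ.toℚᵘ-homo-* (ℚ.fromℚᵘ p) (ℚ.fromℚᵘ q) ⟨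
      ℚ.toℚᵘ (ℚ.fromℚᵘ p ℚ.* ℚ.fromℚᵘ q)                 ∎)
      where open import Relation.Binary.Reasoning.Setoid ℚᵘ.≃-setoid

    fromℚᵘ-homo-neg : ∀ p → ℚ.fromℚᵘ (ℚᵘ.- p) ≡ ℚ.- ℚ.fromℚᵘ p
    fromℚᵘ-homo-neg p = ℚ.toℚᵘ-injective (begin
      ℚ.toℚᵘ (ℚ.fromℚᵘ (ℚᵘ.- p))        ≈⟨ ℚ.toℚᵘ-fromℚᵘ (ℚᵘ.- p) ⟩
      ℚᵘ.- p                             ≈⟨ ℚᵘ.-‿cong (ℚ.toℚᵘ-fromℚᵘ p) ⟨
      ℚᵘ.- ℚ.toℚᵘ (ℚ.fromℚᵘ p)          ≈⟨ ℚ.toℚᵘ-homo‿- (ℚ.fromℚᵘ p) ⟨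
      ℚ.toℚᵘ (ℚ.- ℚ.fromℚᵘ p)           ∎)
      where open import Relation.Binary.Reasoning.Setoid ℚᵘ.≃-setoid

  integer-+ : ∀ a b → integer (a ℤ.+ b) ≈L integer a +L integer b
  integer-+ a b n with does (+ 0 ℤ.≟ n)
  ... | true  = trans (ℚ.+-identityʳ _) (trans /1-homo (cong ((a ℚ./ 1) ℚ.+_) (sym (ℚ.+-identityʳ _))))
    where
    numerators : ∀ a b → (a ℤ.+ b) ℤ.* + 1 ≡ (a ℤ.* + 1 ℤ.+ b ℤ.* + 1) ℤ.* + 1
    numerators = ℤ-Solver.solve-∀
    /1-homo : (a ℤ.+ b) ℚ./ 1 ≡ a ℚ./ 1 ℚ.+ b ℚ./ 1
    /1-homo = trans (ℚ.fromℚᵘ-cong {ℚᵘ.mkℚᵘ (a ℤ.+ b) 0} {ℚᵘ.mkℚᵘ a 0 ℚᵘ.+ ℚᵘ.mkℚᵘ b 0} (ℚᵘ.*≡* (numerators a b)))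
                    (fromℚᵘ-homo-+ (ℚᵘ.mkℚᵘ a 0) (ℚᵘ.mkℚᵘ b 0))
  ... | false = refl

  integer-* : ∀ a b → integer (a ℤ.* b) ≈L integer a *L integer b
  integer-* a b n with does (+ 0 ℤ.≟ n)
  ... | true  = cong (ℚ._+ 0ℚ) (fromℚᵘ-homo-* (ℚᵘ.mkℚᵘ a 0) (ℚᵘ.mkℚᵘ b 0))
  ... | false = refl

  integer-neg : ∀ a → integer (ℤ.- a) ≈L negL (integer a)
  integer-neg a n with does (+ 0 ℤ.≟ n)
  ... | true  = cong (ℚ._+ 0ℚ) (trans (fromℚᵘ-homo-neg (ℚᵘ.mkℚᵘ a 0)) (solve 1 (λ x → :- x := con (ℚ.- 1ℚ) :* x) refl (a ℚ./ 1)))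
  ... | false = refl

  integer-0 : integer (+ 0) ≈L []
  integer-0 n with does (+ 0 ℤ.≟ n)
  ... | true  = refl
  ... | false = refl

  integer-isRingHomomorphism :
    RingMorphisms.IsRingHomomorphism ℤ.+-*-rawRing (CommutativeRing.rawRing laurentRing) integer
  integer-isRingHomomorphism = record
    { isSemiringHomomorphism = record
      { isNearSemiringHomomorphism = record
        { +-isMonoidHomomorphism = record
          { isMagmaHomomorphism = record
            { isRelHomomorphism = record { cong = λ { refl n → refl } }
            ; homo = integer-+ }
          ; ε-homo = integer-0 }
        ; *-homo = integer-* }
      ; 1#-homo = λ n → refl }
    ; -‿homo = integer-neg }

module EvaluationOfP where

  open import Data.Bool using (true; false; if_then_else_; T)
  open import Data.Nat as ℕ using (ℕ; zero; suc; _≤_; _<_; _∸_; _≤ᵇ_)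
  import Data.Nat.Properties as ℕ
  open import Data.Nat.Combinatorics using (_C_)
  import Data.Nat.Tactic.RingSolver as ℕ-Solver
  open import Data.Integer as ℤ using (ℤ; +_)
  import Data.Integer.Properties as ℤ
  import Data.Integer.Tactic.RingSolver as ℤ-Solver
  open import Data.Rational as ℚ using (ℚ)
  import Data.Rational.Properties as ℚ
  open import Data.Rational.Unnormalised using (mkℚᵘ; *≡*)
  open import Data.List using (List; []; _∷_; _++_; concatMap)
  import Data.List.Properties as List
  open import Data.Product using (_×_; _,_)
  open import Relation.Binary.PropositionalEquality as ≡ using (_≡_; refl; cong; cong₂; subst)

  open import Defs
  open Multinomial using (weight; degree; size; waring; 0<size; degree-complement; degree*C*C≡size*waring)
  open Coefficients using (waringCoefficient)
  open Laurent
  open GirardWaring laurentRing integer-isRingHomomorphism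

  private
    divℚ-*-cancel : ∀ x n → 0 < n → divℚ (x ℤ.* + n) n ≡ x ℚ./ 1
    divℚ-*-cancel x (suc n) _ = ℚ.fromℚᵘ-cong {mkℚᵘ (x ℤ.* + suc n) n} {mkℚᵘ x 0} (*≡* (ℤ.*-identityʳ _))

    degree∸k∸2l : ∀ k l j → degree k l j ∸ k ∸ 2 ℕ.* l ≡ size k l j
    degree∸k∸2l k l j = ≡.trans (cong (λ m → m ∸ k ∸ 2 ℕ.* l) (rearrange k l j))
      (≡.trans (cong (_∸ 2 ℕ.* l) (ℕ.m+n∸m≡n k _)) (ℕ.m+n∸m≡n (2 ℕ.* l) (size k l j)))
      where
      rearrange : ∀ k l j → 2 ℕ.* k ℕ.+ 3 ℕ.* l ℕ.+ j ≡ k ℕ.+ (2 ℕ.* l ℕ.+ (k ℕ.+ l ℕ.+ j))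
      rearrange = ℕ-Solver.solve-∀

  Pcoef-degree : ∀ k l j → 0 < size k l j → Pcoef (degree k l j) k l ≡ waringCoefficient k l j ℚ./ 1
  Pcoef-degree k l j 0<n = begin
    Pcoef D k l
      ≡⟨ cong (λ m → divℚ (numerator m) m) (degree∸k∸2l k l j) ⟩
    divℚ (numerator n) n
      ≡⟨ cong (λ z → divℚ z n) numerator≡ ⟩
    divℚ (waringCoefficient k l j ℤ.* + n) n
      ≡⟨ divℚ-*-cancel (waringCoefficient k l j) n 0<n ⟩
    waringCoefficient k l j ℚ./ 1 ∎
    where
    open ≡.≡-Reasoning
    D = degree k l j
    n = size k l j
    numerator : ℕ → ℤ
    numerator m = + D ℤ.* signPred k ℤ.* + ((k ℕ.+ l) C k) ℤ.* + (m C (k ℕ.+ l))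
    numerator≡ : numerator n ≡ waringCoefficient k l j ℤ.* + n
    numerator≡ = begin
      + D ℤ.* σ ℤ.* + C₁ ℤ.* + C₂        ≡⟨ reorder (+ D) σ (+ C₁) (+ C₂) ⟩
      σ ℤ.* (+ D ℤ.* + C₁ ℤ.* + C₂)      ≡⟨ cong (σ ℤ.*_) (≡.trans (ℤ.pos-* (D ℕ.* C₁) C₂) (cong (ℤ._* + C₂) (ℤ.pos-* D C₁))) ⟨
      σ ℤ.* + (D ℕ.* C₁ ℕ.* C₂)          ≡⟨ cong (λ m → σ ℤ.* + m) (degree*C*C≡size*waring k l j) ⟩
      σ ℤ.* + (n ℕ.* waring k l j)       ≡⟨ cong (σ ℤ.*_) (ℤ.pos-* n (waring k l j)) ⟩
      σ ℤ.* (+ n ℤ.* + waring k l j)     ≡⟨ swap σ (+ n) (+ waring k l j) ⟩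
      σ ℤ.* + waring k l j ℤ.* + n       ∎
      where
      σ = signPred k
      C₁ = (k ℕ.+ l) C k
      C₂ = n C (k ℕ.+ l)
      reorder : ∀ d s a b → d ℤ.* s ℤ.* a ℤ.* b ≡ s ℤ.* (d ℤ.* a ℤ.* b)
      reorder = ℤ-Solver.solve-∀
      swap : ∀ s m w → s ℤ.* (m ℤ.* w) ≡ s ℤ.* w ℤ.* m
      swap = ℤ-Solver.solve-∀

  Pcoef-waringCoefficient : ∀ d k l → 0 < d → weight k l ≤ d →
    Pcoef d k l ≡ waringCoefficient k l (d ∸ 2 ℕ.* k ∸ 3 ℕ.* l) ℚ./ 1
  Pcoef-waringCoefficient d k l 0<d w≤d =
    ≡.trans (cong (λ m → Pcoef m k l) (≡.sym deg≡d)) (Pcoef-degree k l j (0<size k l j (subst (0 <_) (≡.sym deg≡d) 0<d)))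
    where
    j = d ∸ 2 ℕ.* k ∸ 3 ℕ.* l
    deg≡d : degree k l j ≡ d
    deg≡d = degree-complement d k l w≤d

  open CommutativeRing laurentRing using (setoid; sym; trans)
  open import Relation.Binary.Reasoning.Setoid setoid

  evalP-++ : ∀ xs ys X Y → evalP (xs ++ ys) X Y ≡ evalP xs X Y ++ evalP ys X Y
  evalP-++ []                  ys X Y = refl
  evalP-++ ((c , k , j) ∷ xs) ys X Y = ≡.trans (cong (scaleL c ((X ^L k) *L (Y ^L j)) ++_) (evalP-++ xs ys X Y))
    (≡.sym (List.++-assoc (scaleL c ((X ^L k) *L (Y ^L j))) (evalP xs X Y) (evalP ys X Y)))

  evalP-concatMap-range : ∀ (F : ℕ → List (ℚ × ℕ × ℕ)) X Y n →
    evalP (concatMap F (range n)) X Y ≈L sum n (λ k → evalP (F k) X Y)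
  evalP-concatMap-range F X Y zero    = sym {integer (+ 0)} {[]} integer-0
  evalP-concatMap-range F X Y (suc n) = begin
    evalP (concatMap F (range n ++ n ∷ [])) X Y
      ≡⟨ cong (λ xs → evalP xs X Y) (List.concatMap-++ F (range n) (n ∷ [])) ⟩
    evalP (concatMap F (range n) ++ (F n ++ [])) X Y
      ≡⟨ evalP-++ (concatMap F (range n)) (F n ++ []) X Y ⟩
    evalP (concatMap F (range n)) X Y ++ evalP (F n ++ []) X Y
      ≡⟨ cong (λ xs → evalP (concatMap F (range n)) X Y ++ evalP xs X Y) (List.++-identityʳ (F n)) ⟩
    evalP (concatMap F (range n)) X Y ++ evalP (F n) X Y
      ≈⟨ +L-cong {evalP (concatMap F (range n)) X Y} {sum n (λ k → evalP (F k) X Y)} {evalP (F n) X Y}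
                 (evalP-concatMap-range F X Y n) (λ _ → refl) ⟩
    sum (suc n) (λ k → evalP (F k) X Y) ∎

  pow≡^L : ∀ x k → pow x k ≡ x ^L k
  pow≡^L x zero    = refl
  pow≡^L x (suc k) = cong (x *L_) (pow≡^L x k)

  pow-oneL : ∀ k → pow oneL k ≈L oneL
  pow-oneL zero    = λ _ → refl
  pow-oneL (suc k) = trans {pow oneL (suc k)} {pow oneL k} {oneL} (*L-identityˡ (pow oneL k)) (pow-oneL k)

  pow-oneL-*L : ∀ l q → pow oneL l *L q ≈L q
  pow-oneL-*L l q = trans {pow oneL l *L q} {oneL *L q} {q}
    (*L-cong {pow oneL l} {oneL} {q} {q} (pow-oneL l) (λ _ → refl)) (*L-identityˡ q)

  scaleL≈integer*L : ∀ z p → scaleL (z ℚ./ 1) p ≈L integer z *L p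
  scaleL≈integer*L z p n = ≡.trans (coeff-scaleL (z ℚ./ 1) p n) (≡.sym (≡.trans (coeff-*L (integer z) p n)
    (≡.trans (ℚ.+-identityʳ _) (cong (λ m → (z ℚ./ 1) ℚ.* coeff p m) (ℤ.+-identityʳ n)))))

  Pterm : ℕ → ℕ → ℕ → List (ℚ × ℕ × ℕ)
  Pterm d k l = if 2 ℕ.* k ℕ.+ 3 ℕ.* l ≤ᵇ d then (Pcoef d k l , k , d ∸ 2 ℕ.* k ∸ 3 ℕ.* l) ∷ [] else []

  evalP-Pterm : ∀ d X Y k l → 0 < d → evalP (Pterm d k l) X Y ≈L waringTerm d X Y oneL k l
  evalP-Pterm d X Y k l 0<d with 2 ℕ.* k ℕ.+ 3 ℕ.* l ≤ᵇ d in w≤ᵇd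
  ... | false = sym {integer (+ 0)} {[]} integer-0
  ... | true  = begin
    scaleL (Pcoef d k l) (X ^L k *L Y ^L j) ++ []
      ≡⟨ List.++-identityʳ _ ⟩
    scaleL (Pcoef d k l) (X ^L k *L Y ^L j)
      ≡⟨ cong (λ a → scaleL a (X ^L k *L Y ^L j)) (Pcoef-waringCoefficient d k l 0<d (ℕ.≤ᵇ⇒≤ _ d (subst T (≡.sym w≤ᵇd) _))) ⟩
    scaleL (c ℚ./ 1) (X ^L k *L Y ^L j)
      ≈⟨ scaleL≈integer*L c (X ^L k *L Y ^L j) ⟩
    integer c *L (X ^L k *L Y ^L j)
      ≡⟨ cong₂ (λ x y → integer c *L (x *L y)) (≡.sym (pow≡^L X k)) (≡.sym (pow≡^L Y j)) ⟩
    integer c *L (pow X k *L pow Y j)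
      ≈⟨ *L-congˡ (integer c) {pow X k *L (pow oneL l *L pow Y j)} {pow X k *L pow Y j}
           (*L-congˡ (pow X k) {pow oneL l *L pow Y j} {pow Y j} (pow-oneL-*L l (pow Y j))) ⟨
    integer c *L (pow X k *L (pow oneL l *L pow Y j)) ∎
    where
    j = d ∸ 2 ℕ.* k ∸ 3 ℕ.* l
    c = waringCoefficient k l j

  evalP-P : ∀ d X Y → 0 < d → evalP (P d) X Y ≈L waringForm d X Y oneL
  evalP-P d X Y 0<d = begin
    evalP (P d) X Y
      ≈⟨ evalP-concatMap-range (λ k → concatMap (Pterm d k) (range (suc d))) X Y (suc d) ⟩
    sum (suc d) (λ k → evalP (concatMap (Pterm d k) (range (suc d))) X Y)
      ≈⟨ (sum-cong (suc d) λ k → evalP-concatMap-range (Pterm d k) X Y (suc d)) ⟩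
    sum (suc d) (λ k → sum (suc d) λ l → evalP (Pterm d k l) X Y)
      ≈⟨ (sum-cong (suc d) λ k → sum-cong (suc d) λ l → evalP-Pterm d X Y k l 0<d) ⟩
    waringForm d X Y oneL ∎

module Specialisation where

  open import Data.Nat as ℕ using (zero; suc; _<_; z≤n; s≤s)
  import Data.Nat.Divisibility as ℕ
  open import Data.Nat.DivMod using (_%_; m%n<n)
  open import Data.Nat.Divisibility using (n∣m⇒m%n≡0; m%n≡0⇒n∣m)
  open import Data.Integer as ℤ using (ℤ; +_; -[1+_]; ∣_∣)
  import Data.Integer.Properties as ℤ
  import Data.Integer.Tactic.RingSolver as ℤ-Solver
  open import Data.Rational as ℚ using (ℚ; 1ℚ)
  import Data.Rational.Properties as ℚ
  open import Data.Rational.Solver using (module +-*-Solver)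
  open import Algebra.Definitions.RawSemiring ℚ.+-*-rawSemiring using (_^_)
  open import Data.List using ([]; _∷_)
  open import Data.Product using (_,_)
  open import Relation.Nullary using (¬_; contradiction)
  open import Relation.Binary.PropositionalEquality as ≡ using (_≡_; refl; cong; cong₂)

  open import Defs
  open Laurent
  open EvaluationOfP using (evalP-P)
  open GirardWaring laurentRing integer-isRingHomomorphism
  open CommutativeRing laurentRing using (setoid; sym)
  open import Relation.Binary.Reasoning.Setoid setoid

  evalP-P-elementary : ∀ d x y z X Y → e₃ x y z ≈L oneL → X ≈L e₂ x y z → Y ≈L e₁ x y z →
    evalP (P (suc d)) X Y ≈L negL (powerSum (suc d) x y z)
  evalP-P-elementary d x y z X Y e₃≈1 X≈e₂ Y≈e₁ = begin
    evalP (P (suc d)) X Y                                 ≈⟨ evalP-P (suc d) X Y (s≤s z≤n) ⟩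
    waringForm (suc d) X Y oneL                           ≈⟨ waringForm-cong (suc d) X≈e₂ Y≈e₁ (sym {e₃ x y z} {oneL} e₃≈1) ⟩
    waringForm (suc d) (e₂ x y z) (e₁ x y z) (e₃ x y z)   ≈⟨ girard-waring d x y z ⟩
    negL (powerSum (suc d) x y z)                         ∎

  pow-monomial : ∀ c e n → pow ((c , e) ∷ []) n ≈L (c ^ n , e ℤ.* + n) ∷ []
  pow-monomial c e zero    m = cong (λ e′ → coeff ((1ℚ , e′) ∷ []) m) (≡.sym (ℤ.*-zeroʳ e))
  pow-monomial c e (suc n) = begin
    ((c , e) ∷ []) *L pow ((c , e) ∷ []) n      ≈⟨ *L-congˡ ((c , e) ∷ []) {pow ((c , e) ∷ []) n} {(c ^ n , e ℤ.* + n) ∷ []} (pow-monomial c e n) ⟩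
    (c ℚ.* c ^ n , e ℤ.+ e ℤ.* + n) ∷ []       ≡⟨ cong (λ e′ → (c ^ suc n , e′) ∷ []) (e+e*m≡e*[1+m] e (+ n)) ⟩
    (c ^ suc n , e ℤ.* + suc n) ∷ []            ∎
    where
    e+e*m≡e*[1+m] : ∀ e m → e ℤ.+ e ℤ.* m ≡ e ℤ.* (+ 1 ℤ.+ m)
    e+e*m≡e*[1+m] = ℤ-Solver.solve-∀

  1^n≡1 : ∀ n → 1ℚ ^ n ≡ 1ℚ
  1^n≡1 zero    = refl
  1^n≡1 (suc n) = cong (1ℚ ℚ.*_) (1^n≡1 n)

  module TrinomialRoots (ε : ℚ) (ε*ε≡1 : ε ℚ.* ε ≡ 1ℚ) (a b : ℤ) where

    x y z : LP
    x = (ε , a) ∷ []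
    y = (1ℚ , b) ∷ []
    z = (ε , ℤ.- (a ℤ.+ b)) ∷ []

    e₃≈1 : e₃ x y z ≈L oneL
    e₃≈1 n = cong₂ (λ c e → coeff ((c , e) ∷ []) n)
      (≡.trans (cong (ℚ._* ε) (ℚ.*-identityʳ ε)) ε*ε≡1) (ℤ.+-inverseʳ (a ℤ.+ b))

    e₂≈ : e₂ x y z ≈L trinomial (ε , ℤ.- a) (1ℚ , ℤ.- b) (ε , a ℤ.+ b)
    e₂≈ = begin
      trinomial (ε ℚ.* 1ℚ , a ℤ.+ b) (ε ℚ.* ε , a ℤ.+ ℤ.- (a ℤ.+ b)) (1ℚ ℚ.* ε , b ℤ.+ ℤ.- (a ℤ.+ b))
        ≈⟨ trinomial-reverse (ε ℚ.* 1ℚ , a ℤ.+ b) (ε ℚ.* ε , a ℤ.+ ℤ.- (a ℤ.+ b)) (1ℚ ℚ.* ε , b ℤ.+ ℤ.- (a ℤ.+ b)) ⟩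
      trinomial (1ℚ ℚ.* ε , b ℤ.+ ℤ.- (a ℤ.+ b)) (ε ℚ.* ε , a ℤ.+ ℤ.- (a ℤ.+ b)) (ε ℚ.* 1ℚ , a ℤ.+ b)
        ≡⟨ trinomial-≡ (cong₂ _,_ (ℚ.*-identityˡ ε) (b-[a+b]≡-a a b)) (cong₂ _,_ ε*ε≡1 (a-[a+b]≡-b a b))
                       (cong (_, a ℤ.+ b) (ℚ.*-identityʳ ε)) ⟩
      trinomial (ε , ℤ.- a) (1ℚ , ℤ.- b) (ε , a ℤ.+ b) ∎
      where
      b-[a+b]≡-a : ∀ a b → b ℤ.+ ℤ.- (a ℤ.+ b) ≡ ℤ.- a
      b-[a+b]≡-a = ℤ-Solver.solve-∀
      a-[a+b]≡-b : ∀ a b → a ℤ.+ ℤ.- (a ℤ.+ b) ≡ ℤ.- b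
      a-[a+b]≡-b = ℤ-Solver.solve-∀

    powerSum≈ : ∀ n → powerSum n x y z ≈L trinomial (ε ^ n , a ℤ.* + n) (1ℚ , b ℤ.* + n) (ε ^ n , ℤ.- (a ℤ.+ b) ℤ.* + n)
    powerSum≈ n = begin
      (pow x n +L pow y n) +L pow z n
        ≈⟨ +L-cong {pow x n +L pow y n} {xⁿ +L yⁿ} {pow z n} {zⁿ}
             (+L-cong {pow x n} {xⁿ} {pow y n} {yⁿ} (pow-monomial ε a n) (pow-monomial 1ℚ b n)) (pow-monomial ε (ℤ.- (a ℤ.+ b)) n) ⟩
      trinomial (ε ^ n , a ℤ.* + n) (1ℚ ^ n , b ℤ.* + n) (ε ^ n , ℤ.- (a ℤ.+ b) ℤ.* + n)
        ≡⟨ cong (λ c → trinomial (ε ^ n , a ℤ.* + n) (c , b ℤ.* + n) (ε ^ n , ℤ.- (a ℤ.+ b) ℤ.* + n)) (1^n≡1 n) ⟩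
      trinomial (ε ^ n , a ℤ.* + n) (1ℚ , b ℤ.* + n) (ε ^ n , ℤ.- (a ℤ.+ b) ℤ.* + n) ∎
      where
      xⁿ = (ε ^ n , a ℤ.* + n) ∷ []
      yⁿ = (1ℚ ^ n , b ℤ.* + n) ∷ []
      zⁿ = (ε ^ n , ℤ.- (a ℤ.+ b) ℤ.* + n) ∷ []

    evalP-P-trinomial : ∀ m → 0 < m →
      evalP (P m) (trinomial (ε , ℤ.- a) (1ℚ , ℤ.- b) (ε , a ℤ.+ b)) (trinomial (ε , a) (1ℚ , b) (ε , ℤ.- (a ℤ.+ b)))
        ≈L negL (trinomial (ε ^ m , a ℤ.* + m) (1ℚ , b ℤ.* + m) (ε ^ m , ℤ.- (a ℤ.+ b) ℤ.* + m))
    evalP-P-trinomial (suc d) _ = begin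
      evalP (P (suc d)) (trinomial (ε , ℤ.- a) (1ℚ , ℤ.- b) (ε , a ℤ.+ b)) (e₁ x y z)
        ≈⟨ evalP-P-elementary d x y z _ _ e₃≈1 (sym {e₂ x y z} {trinomial (ε , ℤ.- a) (1ℚ , ℤ.- b) (ε , a ℤ.+ b)} e₂≈) (λ _ → refl) ⟩
      negL (powerSum (suc d) x y z)
        ≈⟨ negL-cong {powerSum (suc d) x y z} {trinomial (ε ^ suc d , a ℤ.* + suc d) (1ℚ , b ℤ.* + suc d) (ε ^ suc d , ℤ.- (a ℤ.+ b) ℤ.* + suc d)}
             (powerSum≈ (suc d)) ⟩
      negL (trinomial (ε ^ suc d , a ℤ.* + suc d) (1ℚ , b ℤ.* + suc d) (ε ^ suc d , ℤ.- (a ℤ.+ b) ℤ.* + suc d)) ∎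

  private
    -a*-1≡a : ∀ a → (ℤ.- a) ℤ.* -[1+ 0 ] ≡ a
    -a*-1≡a = ℤ-Solver.solve-∀
    a*-1≡-a : ∀ a → a ℤ.* -[1+ 0 ] ≡ ℤ.- a
    a*-1≡-a = ℤ-Solver.solve-∀
    a*m≡-a*[-1*m] : ∀ a m → a ℤ.* m ≡ (ℤ.- a) ℤ.* (-[1+ 0 ] ℤ.* m)
    a*m≡-a*[-1*m] = ℤ-Solver.solve-∀
    -a*m≡a*[-1*m] : ∀ a m → ℤ.- a ℤ.* m ≡ a ℤ.* (-[1+ 0 ] ℤ.* m)
    -a*m≡a*[-1*m] = ℤ-Solver.solve-∀

  substPow-S-at-1/T : ∀ a b → substPow (S a b) -[1+ 0 ] ≡ trinomial (1ℚ , a) (1ℚ , b) (1ℚ , ℤ.- (a ℤ.+ b))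
  substPow-S-at-1/T a b = trinomial-≡ (cong (1ℚ ,_) (-a*-1≡a a)) (cong (1ℚ ,_) (-a*-1≡a b)) (cong (1ℚ ,_) (a*-1≡-a (a ℤ.+ b)))

  substPow-S-at-1/Tᵐ : ∀ a b c m → c ≡ 1ℚ →
    trinomial (c , a ℤ.* + m) (1ℚ , b ℤ.* + m) (c , ℤ.- (a ℤ.+ b) ℤ.* + m) ≡ substPow (S a b) (-[1+ 0 ] ℤ.* + m)
  substPow-S-at-1/Tᵐ a b c m refl = trinomial-≡
    (cong (1ℚ ,_) (a*m≡-a*[-1*m] a (+ m))) (cong (1ℚ ,_) (a*m≡-a*[-1*m] b (+ m))) (cong (1ℚ ,_) (-a*m≡a*[-1*m] (a ℤ.+ b) (+ m)))

  S-identity : ∀ a b m → 0 < m →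
    evalP (P m) (S a b) (substPow (S a b) -[1+ 0 ]) ≈L negL (substPow (S a b) (-[1+ 0 ] ℤ.* + m))
  S-identity a b m 0<m = begin
    evalP (P m) (S a b) (substPow (S a b) -[1+ 0 ])
      ≡⟨ cong (evalP (P m) (S a b)) (substPow-S-at-1/T a b) ⟩
    evalP (P m) (S a b) (trinomial (1ℚ , a) (1ℚ , b) (1ℚ , ℤ.- (a ℤ.+ b)))
      ≈⟨ TrinomialRoots.evalP-P-trinomial 1ℚ refl a b m 0<m ⟩
    negL (trinomial (1ℚ ^ m , a ℤ.* + m) (1ℚ , b ℤ.* + m) (1ℚ ^ m , ℤ.- (a ℤ.+ b) ℤ.* + m))
      ≡⟨ cong negL (substPow-S-at-1/Tᵐ a b (1ℚ ^ m) m (1^n≡1 m)) ⟩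
    negL (substPow (S a b) (-[1+ 0 ] ℤ.* + m)) ∎

  -1ℚ : ℚ
  -1ℚ = ℚ.- 1ℚ

  private
    -1^m≡-1^[m%2] : ∀ m → -1ℚ ^ m ≡ -1ℚ ^ (m % 2)
    -1^m≡-1^[m%2] zero          = refl
    -1^m≡-1^[m%2] (suc zero)    = refl
    -1^m≡-1^[m%2] (suc (suc m)) = ≡.trans (-1*[-1*x]≡x (-1ℚ ^ m)) (-1^m≡-1^[m%2] m)
      where
      open +-*-Solver
      -1*[-1*x]≡x : ∀ x → -1ℚ ℚ.* (-1ℚ ℚ.* x) ≡ x
      -1*[-1*x]≡x = solve 1 (λ x → con -1ℚ :* (con -1ℚ :* x) := x) refl

  -1^even : ∀ m → 2 ℕ.∣ m → -1ℚ ^ m ≡ 1ℚ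
  -1^even m 2∣m = ≡.trans (-1^m≡-1^[m%2] m) (cong (-1ℚ ^_) (n∣m⇒m%n≡0 m 2 2∣m))

  -1^odd : ∀ m → ¬ 2 ℕ.∣ m → -1ℚ ^ m ≡ -1ℚ
  -1^odd m 2∤m with m % 2 in m%2≡r | m%n<n m 2
  ... | zero        | _ = contradiction (m%n≡0⇒n∣m m 2 m%2≡r) 2∤m
  ... | suc zero    | _ = ≡.trans (-1^m≡-1^[m%2] m) (cong (-1ℚ ^_) m%2≡r)
  ... | suc (suc _) | s≤s (s≤s ())

  negOnePow-odd : ∀ n → ¬ 2 ℕ.∣ ∣ n ∣ → negOnePow n ≡ -1ℚ
  negOnePow-odd n 2∤n with ∣ n ∣ % 2 in ∣n∣%2≡r
  ... | zero  = contradiction (m%n≡0⇒n∣m ∣ n ∣ 2 ∣n∣%2≡r) 2∤n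
  ... | suc _ = refl

  module _ (a b : ℤ) (odd-sign : negOnePow (a ℤ.+ b) ≡ -1ℚ) where

    negL-R : negL (R a b) ≡ trinomial (-1ℚ , ℤ.- a) (1ℚ , ℤ.- b) (-1ℚ , a ℤ.+ b)
    negL-R = trinomial-≡ refl (cong (λ s → (-1ℚ ℚ.* s , ℤ.- b)) odd-sign) refl

    negL-R-at-1/T : negL (substPow (R a b) -[1+ 0 ]) ≡ trinomial (-1ℚ , a) (1ℚ , b) (-1ℚ , ℤ.- (a ℤ.+ b))
    negL-R-at-1/T = trinomial-≡ (cong (-1ℚ ,_) (-a*-1≡a a)) (cong₂ (λ s e → (-1ℚ ℚ.* s , e)) odd-sign (-a*-1≡a b))
                                (cong (-1ℚ ,_) (a*-1≡-a (a ℤ.+ b)))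

    R-identity : ∀ m → 0 < m →
      evalP (P m) (negL (R a b)) (negL (substPow (R a b) -[1+ 0 ]))
        ≈L negL (trinomial (-1ℚ ^ m , a ℤ.* + m) (1ℚ , b ℤ.* + m) (-1ℚ ^ m , ℤ.- (a ℤ.+ b) ℤ.* + m))
    R-identity m 0<m = begin
      evalP (P m) (negL (R a b)) (negL (substPow (R a b) -[1+ 0 ]))
        ≡⟨ cong₂ (evalP (P m)) negL-R negL-R-at-1/T ⟩
      evalP (P m) (trinomial (-1ℚ , ℤ.- a) (1ℚ , ℤ.- b) (-1ℚ , a ℤ.+ b)) (trinomial (-1ℚ , a) (1ℚ , b) (-1ℚ , ℤ.- (a ℤ.+ b)))
        ≈⟨ TrinomialRoots.evalP-P-trinomial -1ℚ refl a b m 0<m ⟩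
      negL (trinomial (-1ℚ ^ m , a ℤ.* + m) (1ℚ , b ℤ.* + m) (-1ℚ ^ m , ℤ.- (a ℤ.+ b) ℤ.* + m)) ∎

    R-identity-even : ∀ m → 0 < m → 2 ℕ.∣ m →
      evalP (P m) (negL (R a b)) (negL (substPow (R a b) -[1+ 0 ])) ≈L negL (substPow (S a b) (-[1+ 0 ] ℤ.* + m))
    R-identity-even m 0<m 2∣m = begin
      evalP (P m) (negL (R a b)) (negL (substPow (R a b) -[1+ 0 ]))
        ≈⟨ R-identity m 0<m ⟩
      negL (trinomial (-1ℚ ^ m , a ℤ.* + m) (1ℚ , b ℤ.* + m) (-1ℚ ^ m , ℤ.- (a ℤ.+ b) ℤ.* + m))
        ≡⟨ cong negL (substPow-S-at-1/Tᵐ a b (-1ℚ ^ m) m (-1^even m 2∣m)) ⟩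
      negL (substPow (S a b) (-[1+ 0 ] ℤ.* + m)) ∎

    R-identity-odd : ∀ m → 0 < m → ¬ 2 ℕ.∣ m →
      evalP (P m) (negL (R a b)) (negL (substPow (R a b) -[1+ 0 ])) ≈L substPow (R a b) (-[1+ 0 ] ℤ.* + m)
    R-identity-odd m 0<m 2∤m = begin
      evalP (P m) (negL (R a b)) (negL (substPow (R a b) -[1+ 0 ]))
        ≈⟨ R-identity m 0<m ⟩
      negL (trinomial (-1ℚ ^ m , a ℤ.* + m) (1ℚ , b ℤ.* + m) (-1ℚ ^ m , ℤ.- (a ℤ.+ b) ℤ.* + m))
        ≡⟨ trinomial-≡ (cong₂ (λ c e → (-1ℚ ℚ.* c , e)) (-1^odd m 2∤m) (a*m≡-a*[-1*m] a (+ m)))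
                       (cong₂ _,_ (≡.sym odd-sign) (a*m≡-a*[-1*m] b (+ m)))
                       (cong₂ (λ c e → (-1ℚ ℚ.* c , e)) (-1^odd m 2∤m) (-a*m≡a*[-1*m] (a ℤ.+ b) (+ m))) ⟩
      substPow (R a b) (-[1+ 0 ] ℤ.* + m) ∎

open Specialisation using (-1ℚ; S-identity; R-identity-even; R-identity-odd; negOnePow-odd)

open import Defs
open import Data.Integer using (ℤ; +_; -[1+_]; ∣_∣; _+_; _*_)
open import Data.Integer.Divisibility using (_∣_)
open import Data.Sum using (_⊎_)
open import Data.Product using (_×_)
open import Relation.Nullary using (¬_)
open import Relation.Binary.PropositionalEquality using (_≡_; _≢_)

open import Data.Nat using (_<_)
import Data.Nat.Properties as ℕ
import Data.Integer.Properties as ℤ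
import Data.Integer.Divisibility.Signed as Signed
open import Data.Sum using (inj₁; inj₂)
open import Data.Product using (_,_)
open import Relation.Binary.PropositionalEquality using (refl)
open import Function using (_∘_)

mainTheorem2 : (a b : ℤ) → a ≢ + 0 → b ≢ + 0 → a + b ≢ + 0 →
      ((d : ℤ) → d ≡ a ⊎ d ≡ b ⊎ d ≡ a + b →
        evalP (P ∣ d ∣) (S a b) (substPow (S a b) -[1+ 0 ])
          ≈L negL (substPow (S a b) (-[1+ 0 ] * + ∣ d ∣)))
    × (+ 2 ∣ a → ¬ (+ 2 ∣ b) →
        ((d : ℤ) → d ≡ a →
          evalP (P ∣ d ∣) (negL (R a b)) (negL (substPow (R a b) -[1+ 0 ]))
            ≈L negL (substPow (S a b) (-[1+ 0 ] * + ∣ d ∣)))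
      × ((d : ℤ) → d ≡ b ⊎ d ≡ a + b →
          evalP (P ∣ d ∣) (negL (R a b)) (negL (substPow (R a b) -[1+ 0 ]))
            ≈L substPow (R a b) (-[1+ 0 ] * + ∣ d ∣)))
mainTheorem2 a b a≢0 b≢0 a+b≢0 =
    (λ d d∈abc → S-identity a b ∣ d ∣ (0<∣ nonzero d∈abc ∣))
  , λ 2∣a 2∤b →
        (λ { d refl → R-identity-even a b (sign 2∣a 2∤b) ∣ a ∣ 0<∣ a≢0 ∣ 2∣a })
      , (λ d d∈bc → R-identity-odd a b (sign 2∣a 2∤b) ∣ d ∣ (0<∣ nonzero (inj₂ d∈bc) ∣) (odd 2∣a 2∤b d∈bc))
  where
  0<∣_∣ : ∀ {d} → d ≢ + 0 → 0 < ∣ d ∣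
  0<∣ d≢0 ∣ = ℕ.n≢0⇒n>0 (d≢0 ∘ ℤ.∣i∣≡0⇒i≡0)

  nonzero : ∀ {d} → d ≡ a ⊎ d ≡ b ⊎ d ≡ a + b → d ≢ + 0
  nonzero (inj₁ refl)        = a≢0
  nonzero (inj₂ (inj₁ refl)) = b≢0
  nonzero (inj₂ (inj₂ refl)) = a+b≢0

  odd : + 2 ∣ a → ¬ (+ 2 ∣ b) → ∀ {d} → d ≡ b ⊎ d ≡ a + b → ¬ (+ 2 ∣ d)
  odd 2∣a 2∤b (inj₁ refl) = 2∤b
  odd 2∣a 2∤b (inj₂ refl) 2∣a+b =
    2∤b (Signed.∣⇒∣ᵤ (Signed.∣m+n∣m⇒∣n {+ 2} {a} {b} (Signed.∣ᵤ⇒∣ 2∣a+b) (Signed.∣ᵤ⇒∣ 2∣a)))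

  sign : + 2 ∣ a → ¬ (+ 2 ∣ b) → negOnePow (a + b) ≡ -1ℚ
  sign 2∣a 2∤b = negOnePow-odd (a + b) (odd 2∣a 2∤b (inj₂ refl))
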